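{- There is a uniformly highly computable sequence of trees $(G_e)_{e\in\mathbb{N}}$ such that the collection of finite sets of edges $E\subset E(G_e)$ for which $G_e\smallsetminus E$ has at least two infinite connected components is uniformly computable (in $e$), but the number of ends of $G_e$ is not (uniformly computable in $e$).
   Context: A graph $G$ is highly computable when $V(G)$ is a decidable subset of $\mathbb{N}$, the adjacency relation is decidable, $G$ is locally finite and the vertex degree function is computable; a sequence $(G_e)$ is uniformly highly computable when vertex sets, adjacency and degree functions are computable uniformly in $e$. $G\smallsetminus E$ is the subgraph induced by $E(G)\smallsetminus E$. The number of ends of $G$ is the supremum, over finite $E\subset E(G)$, of the number of infinite connected components of $G\smallsetminus E$. -}

module Defs where

open import Data.Nat using (ℕ; zero; suc; _+_; _<_; _≥_)
open import Data.Bool using (Bool; true; false)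
open import Data.Fin using (Fin)
open import Data.List using (List; []; _∷_; length)
open import Data.List.Membership.Propositional using (_∈_)
open import Data.List.Relation.Unary.All using (All)
open import Data.List.Relation.Unary.Unique.Propositional using (Unique)
open import Data.Maybe using (Maybe; just; nothing)
open import Data.Product using (Σ; _×_; _,_; ∃)
open import Data.Sum using (_⊎_)
open import Data.Empty using (⊥)
open import Relation.Nullary using (¬_)
open import Relation.Binary.PropositionalEquality using (_≡_; _≢_)

data Code : Set where
  zeroᶜ : Code
  succᶜ : Code
  projᶜ : ℕ → Code                  -- i-th argument (0-based)
  compᶜ : Code → List Code → Code
  precᶜ : Code → Code → Code        -- primitive recursion on first argument
  minᶜ  : Code → Code

nth : List ℕ → ℕ → Maybe ℕ
nth []       _       = nothing
nth (x ∷ xs) zero    = just x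
nth (x ∷ xs) (suc i) = nth xs i

mutual
  data Eval : Code → List ℕ → ℕ → Set where
    ev-zero  : ∀ {xs} → Eval zeroᶜ xs 0
    ev-succ  : ∀ {x xs} → Eval succᶜ (x ∷ xs) (suc x)
    ev-proj  : ∀ {i xs x} → nth xs i ≡ just x → Eval (projᶜ i) xs x
    ev-comp  : ∀ {f gs xs ys y} → EvalAll gs xs ys → Eval f ys y →
               Eval (compᶜ f gs) xs y
    ev-prec0 : ∀ {f g xs y} → Eval f xs y → Eval (precᶜ f g) (0 ∷ xs) y
    ev-precS : ∀ {f g n xs r y} → Eval (precᶜ f g) (n ∷ xs) r →
               Eval g (n ∷ r ∷ xs) y → Eval (precᶜ f g) (suc n ∷ xs) y
    ev-min   : ∀ {f xs y} → Eval f (y ∷ xs) 0 →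
               (∀ z → z < y → Σ ℕ λ k → Eval f (z ∷ xs) (suc k)) →
               Eval (minᶜ f) xs y

  data EvalAll : List Code → List ℕ → List ℕ → Set where
    []  : ∀ {xs} → EvalAll [] xs []
    _∷_ : ∀ {g gs xs y ys} → Eval g xs y → EvalAll gs xs ys →
          EvalAll (g ∷ gs) xs (y ∷ ys)

Computable₁ : (ℕ → ℕ) → Set
Computable₁ f = Σ Code λ c → ∀ a → Eval c (a ∷ []) (f a)

Computable₂ : (ℕ → ℕ → ℕ) → Set
Computable₂ f = Σ Code λ c → ∀ a b → Eval c (a ∷ b ∷ []) (f a b)

Computable₃ : (ℕ → ℕ → ℕ → ℕ) → Set
Computable₃ f = Σ Code λ c → ∀ a b d → Eval c (a ∷ b ∷ d ∷ []) (f a b d)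

χ : Bool → ℕ
χ true  = 1
χ false = 0

tri : ℕ → ℕ
tri zero    = zero
tri (suc n) = suc n + tri n

pair : ℕ → ℕ → ℕ
pair a b = tri (a + b) + b

encEdges : List (ℕ × ℕ) → ℕ
encEdges []             = 0
encEdges ((a , b) ∷ xs) = suc (pair (pair a b) (encEdges xs))

record Graph : Set where
  field
    V       : ℕ → Bool
    Adj     : ℕ → ℕ → Bool
    adj-sym : ∀ u v → Adj u v ≡ Adj v u
    adj-irr : ∀ v → Adj v v ≡ false
    adj-V   : ∀ u v → Adj u v ≡ true → V u ≡ true
    deg     : ℕ → ℕ
    deg-ok  : ∀ v → V v ≡ true →
              Σ (List ℕ) λ L → Unique L × (∀ w → (w ∈ L → Adj v w ≡ true) × (Adj v w ≡ true → w ∈ L))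
                               × length L ≡ deg v
open Graph public

UniformlyHighlyComputable : (ℕ → Graph) → Set
UniformlyHighlyComputable G =
  Computable₂ (λ e v → χ (V (G e) v)) ×
  Computable₃ (λ e u v → χ (Adj (G e) u v)) ×
  Computable₂ (λ e v → deg (G e) v)

Walk : Graph → List ℕ → Set
Walk G []           = ⊥ → ⊥
Walk G (x ∷ [])     = ⊥ → ⊥
Walk G (x ∷ y ∷ xs) = (Adj G x y ≡ true) × Walk G (y ∷ xs)

IsCycle : Graph → ℕ → List ℕ → Set
IsCycle G v₀ vs = length vs ≥ 2 × Unique (v₀ ∷ vs) × Walk G (v₀ ∷ vs) × ClosesAt vs
  where
  ClosesAt : List ℕ → Set
  ClosesAt []           = ⊥
  ClosesAt (x ∷ [])     = Adj G x v₀ ≡ true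
  ClosesAt (x ∷ y ∷ ys) = ClosesAt (y ∷ ys)

-- edges removed: E is a list of (ordered representatives of) edges
Removed : List (ℕ × ℕ) → ℕ → ℕ → Set
Removed E u v = ((u , v) ∈ E) ⊎ ((v , u) ∈ E)

data Reach (G : Graph) (E : List (ℕ × ℕ)) (u : ℕ) : ℕ → Set where
  here : Reach G E u u
  step : ∀ {v w} → Reach G E u v → Adj G v w ≡ true → ¬ Removed E v w →
         Reach G E u w

IsTree : Graph → Set
IsTree G = (∃ λ v → V G v ≡ true)
         × (∀ u v → V G u ≡ true → V G v ≡ true → Reach G [] u v)
         × (∀ v₀ vs → ¬ IsCycle G v₀ vs)

Finite : (ℕ → Set) → Set
Finite P = Σ (List ℕ) λ L → ∀ x → P x → x ∈ L

EdgeSet : Graph → List (ℕ × ℕ) → Set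
EdgeSet G E = All (λ p → Adj G (Data.Product.proj₁ p) (Data.Product.proj₂ p) ≡ true) E

AtLeastInfComps : Graph → List (ℕ × ℕ) → ℕ → Set
AtLeastInfComps G E k =
  Σ (Fin k → ℕ) λ vs →
    (∀ i → V G (vs i) ≡ true) ×
    (∀ i j → i ≢ j → ¬ Reach G E (vs i) (vs j)) ×
    (∀ i → ¬ Finite (Reach G E (vs i)))

EndsAtLeast : Graph → ℕ → Set
EndsAtLeast G k = Σ (List (ℕ × ℕ)) λ E → EdgeSet G E × AtLeastInfComps G E k

-- HasEnds G n : the number of ends of G is n, coded in ℕ ∪ {∞} as
--   0 ↦ ∞,  suc k ↦ k.
HasEnds : Graph → ℕ → Set
HasEnds G zero    = ∀ k → EndsAtLeast G k
HasEnds G (suc k) = EndsAtLeast G k × ¬ EndsAtLeast G (suc k)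

InTwoInfColl : Graph → List (ℕ × ℕ) → Set
InTwoInfColl G E = EdgeSet G E × AtLeastInfComps G E 2

TwoInfUniformlyComputable : (ℕ → Graph) → Set
TwoInfUniformlyComputable G =
  Σ Code λ c → ∀ e E →
    (InTwoInfColl (G e) E → Eval c (e ∷ encEdges E ∷ []) 1) ×
    (¬ InTwoInfColl (G e) E → Eval c (e ∷ encEdges E ∷ []) 0)

EndsUniformlyComputable : (ℕ → Graph) → Set
EndsUniformlyComputable G =
  Σ Code λ c → ∀ e → Σ ℕ λ n → Eval c (e ∷ []) n × HasEnds (G e) n

-- Let h e j say that the program coded by e, run on input e, has halted with output 2 within
-- j steps of a universal machine; h is monotone in j and computable in (e , j). The tree G e is
-- the ray 0 — 2 — 4 — ⋯ (the trunk) together with the ray of odd vertices 2a+1 with h e a,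
-- hung from the trunk at the least such a. So G e has two ends if e outputs 2 on e, and one end
-- otherwise. Removing a finite set of edges leaves two infinite components exactly when one of
-- them lies on the second ray, hangs it, or is a trunk edge 2j — 2j+2 with h e j: a decidable
-- condition. Finally, if a program c computed the number of ends (where the output 2 codes one
-- end), then G ⌜c⌝ would have one end iff c outputs 2 on ⌜c⌝, iff G ⌜c⌝ has two ends.

module Submission where

open import Defs
open import Data.Bool using (Bool; true; false; not; _∧_; _∨_; if_then_else_)
open import Data.Bool.ListAction using (all; any)
open import Data.Bool.Properties
  using (∨-zeroʳ; ∨-assoc; ∨-identityʳ; ∧-comm; ∧-zeroʳ; ∧-assoc; ∧-identityʳ; ¬-not)
open import Data.Empty using (⊥; ⊥-elim)
open import Data.Fin using (Fin; toℕ; inject≤)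
open import Data.Fin.Properties using (inject≤-injective)
open import Data.List using (List; []; _∷_; _++_; map; length; reverse; _ʳ++_; applyUpTo)
open import Data.List.Extrema.Nat using (max; xs≤max)
import Data.List.Membership.DecPropositional
open import Data.List.Membership.Propositional using (_∈_)
open import Data.List.Membership.Propositional.Properties using (∈-map⁺; ∈-map⁻; ∈-applyUpTo⁺)
open import Data.List.Properties using (ʳ++-defn; ++-identityʳ; reverse-involutive)
open import Data.List.Relation.Binary.Pointwise using (Pointwise; []; _∷_; reverse⁺)
open import Data.List.Relation.Unary.All using ([]; _∷_)
import Data.List.Relation.Unary.All as All
open import Data.List.Relation.Unary.AllPairs using ([]; _∷_)
open import Data.List.Relation.Unary.Any using (here; there)
open import Data.List.Relation.Unary.Unique.Propositional using (Unique)
import Data.List.Relation.Unary.Unique.Propositional.Properties as Unique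
open import Data.Maybe using (just)
open import Data.Nat using (ℕ; zero; suc; _+_; _∸_; _≤_; _<_; z≤n; s≤s; pred; _≤?_)
open import Data.Nat.Properties
import Data.Product
open import Data.Product using (Σ; _×_; _,_; proj₁; proj₂; ∃; uncurry)
open import Data.Product.Properties using (≡-dec)
import Data.Sum
open import Data.Sum using (_⊎_; inj₁; inj₂; [_,_])
open import Data.Unit using (⊤; tt)
open import Data.Vec using (Vec; lookup; tabulate; toList) renaming ([] to []ᵛ; _∷_ to _∷ᵛ_)
open import Data.Vec.N-ary using (N-ary; curryⁿ; _$ⁿ_; Eq; appⁿ-cong; left-inverse)
open import Function using (_∘_)
open import Relation.Binary.Construct.Closure.ReflexiveTransitive using (Star; ε; _◅_; _◅◅_)
open import Relation.Binary.Construct.Closure.ReflexiveTransitive.Properties using (module StarReasoning)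
open import Relation.Binary.Definitions using (tri<; tri≈; tri>)
open import Relation.Binary.PropositionalEquality hiding ([_])
open import Relation.Nullary using (¬_; Dec; does; yes; no)
open import Relation.Nullary.Decidable using (dec-true; _⊎-dec_)

does-true : ∀ {A : Set} (d : Dec A) → does d ≡ true → A
does-true (yes a) _ = a

if-dec : ∀ {A : Set} (P : ℕ → Set) (d : Dec A) {x y} → (A → P x) → (¬ A → P y) →
         P (if does d then x else y)
if-dec P (yes a) on-yes on-no = on-yes a
if-dec P (no ¬a) on-yes on-no = on-no ¬a

∧-true : ∀ {x y} → x ∧ y ≡ true → x ≡ true × y ≡ true
∧-true {true} y≡true = refl , y≡true

∨-true : ∀ {x y} → x ∨ y ≡ true → x ≡ true ⊎ y ≡ true
∨-true {true}  _      = inj₁ refl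
∨-true {false} y≡true = inj₂ y≡true

true⇔⇒≡ : ∀ {x y} → (x ≡ true → y ≡ true) → (y ≡ true → x ≡ true) → x ≡ y
true⇔⇒≡ {false} {false} _   _   = refl
true⇔⇒≡ {false} {true}  _   y⇒x = y⇒x refl
true⇔⇒≡ {true}  {false} x⇒y _   = sym (x⇒y refl)
true⇔⇒≡ {true}  {true}  _   _   = refl

module _ {A : Set} (p : A → Bool) where

  all-true⁻ : ∀ xs → all p xs ≡ true → All.All (λ x → p x ≡ true) xs
  all-true⁻ []       _          = []
  all-true⁻ (x ∷ xs) all≡true = proj₁ (∧-true all≡true) ∷ all-true⁻ xs (proj₂ (∧-true {p x} all≡true))

  all-true⁺ : ∀ {xs} → All.All (λ x → p x ≡ true) xs → all p xs ≡ true
  all-true⁺ []         = refl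
  all-true⁺ (px ∷ pxs) = cong₂ _∧_ px (all-true⁺ pxs)

  any-true⁻ : ∀ xs → any p xs ≡ true → ∃ λ x → x ∈ xs × p x ≡ true
  any-true⁻ (x ∷ xs) any≡true with p x in px
  ... | true  = x , here refl , px
  ... | false = Data.Product.map₂ (Data.Product.map₁ there) (any-true⁻ xs any≡true)

  any-false⁻ : ∀ xs → any p xs ≡ false → All.All (λ x → p x ≡ false) xs
  any-false⁻ []       _           = []
  any-false⁻ (x ∷ xs) any≡false with p x in px
  ... | false = px ∷ any-false⁻ xs any≡false

record CFun (m : ℕ) : Set where
  field
    code    : Code
    fun     : Vec ℕ m → ℕ
    correct : ∀ xs → Eval code (toList xs) (fun xs)
open CFun

data Term (n : ℕ) : Set where
  var : Fin n → Term n
  app : ∀ {m} → CFun m → Vec (Term n) m → Term n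

mutual
  ⟦_⟧ : ∀ {n} → Term n → Vec ℕ n → ℕ
  ⟦ var i ⟧    xs = lookup xs i
  ⟦ app F ts ⟧ xs = fun F (⟦ ts ⟧* xs)

  ⟦_⟧* : ∀ {n m} → Vec (Term n) m → Vec ℕ n → Vec ℕ m
  ⟦ []ᵛ ⟧*     xs = []ᵛ
  ⟦ t ∷ᵛ ts ⟧* xs = ⟦ t ⟧ xs ∷ᵛ ⟦ ts ⟧* xs

mutual
  compile : ∀ {n} → Term n → Code
  compile (var i)    = projᶜ (toℕ i)
  compile (app F ts) = compᶜ (code F) (compile* ts)

  compile* : ∀ {n m} → Vec (Term n) m → List Code
  compile* []ᵛ       = []
  compile* (t ∷ᵛ ts) = compile t ∷ compile* ts

nth-toList : ∀ {n} (xs : Vec ℕ n) i → nth (toList xs) (toℕ i) ≡ just (lookup xs i)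
nth-toList (x ∷ᵛ xs) Fin.zero    = refl
nth-toList (x ∷ᵛ xs) (Fin.suc i) = nth-toList xs i

mutual
  compile-correct : ∀ {n} (t : Term n) xs → Eval (compile t) (toList xs) (⟦ t ⟧ xs)
  compile-correct (var i)    xs = ev-proj (nth-toList xs i)
  compile-correct (app F ts) xs = ev-comp (compile*-correct ts xs) (correct F (⟦ ts ⟧* xs))

  compile*-correct : ∀ {n m} (ts : Vec (Term n) m) xs →
                     EvalAll (compile* ts) (toList xs) (toList (⟦ ts ⟧* xs))
  compile*-correct []ᵛ       xs = []
  compile*-correct (t ∷ᵛ ts) xs = compile-correct t xs ∷ compile*-correct ts xs

call : ∀ {m n} → CFun m → N-ary m (Term n) (Term n)
call F = curryⁿ (app F)

term : ∀ {m} → N-ary m (Term m) (Term m) → CFun m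
term t = record { code = compile body ; fun = ⟦ body ⟧ ; correct = compile-correct body }
  where body = t $ⁿ tabulate var

realise : ∀ {m} (F : CFun m) (f : N-ary m ℕ ℕ) → Eq m _≡_ (curryⁿ (fun F)) f → CFun m
realise F f F≗f = record
  { code    = code F
  ; fun     = f $ⁿ_
  ; correct = λ xs → subst (Eval (code F) (toList xs))
                           (trans (sym (left-inverse (fun F) xs)) (appⁿ-cong _≡_ _ f F≗f xs))
                           (correct F xs)
  }

compute : ∀ {m} (t : N-ary m (Term m) (Term m)) (f : N-ary m ℕ ℕ) →
          Eq m _≡_ (curryⁿ (fun (term t))) f → CFun m
compute t = realise (term t)

recursion : ∀ {m} (F : CFun m) (G : CFun (suc (suc m))) (f : N-ary (suc m) ℕ ℕ) →
            Eq m _≡_ (curryⁿ (fun F)) (f 0) →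
            (∀ n → Eq m _≡_ (curryⁿ λ xs → fun G (n ∷ᵛ (f n $ⁿ xs) ∷ᵛ xs)) (f (suc n))) →
            CFun (suc m)
recursion {m} F G f base next = record { code = precᶜ (code F) (code G) ; fun = f $ⁿ_ ; correct = go }
  where
  go : ∀ xs → Eval (precᶜ (code F) (code G)) (toList xs) (f $ⁿ xs)
  go (zero ∷ᵛ xs)  = ev-prec0 (subst (Eval (code F) (toList xs))
    (trans (sym (left-inverse (fun F) xs)) (appⁿ-cong _≡_ _ _ base xs)) (correct F xs))
  go (suc n ∷ᵛ xs) = ev-precS (go (n ∷ᵛ xs)) (subst (Eval (code G) _)
    (trans (sym (left-inverse (λ ys → fun G (n ∷ᵛ (f n $ⁿ ys) ∷ᵛ ys)) xs)) (appⁿ-cong _≡_ _ _ (next n) xs))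
    (correct G (n ∷ᵛ (f n $ⁿ xs) ∷ᵛ xs)))

zeroᶠ : CFun 0
zeroᶠ = record { code = zeroᶜ ; fun = λ _ → 0 ; correct = λ { []ᵛ → ev-zero } }

succᶠ : CFun 1
succᶠ = record { code = succᶜ ; fun = λ { (x ∷ᵛ []ᵛ) → suc x } ; correct = λ { (x ∷ᵛ []ᵛ) → ev-succ } }

num : ∀ {n} → ℕ → Term n
num zero    = call zeroᶠ
num (suc k) = call succᶠ (num k)

ifz : ℕ → ℕ → ℕ → ℕ
ifz zero    a b = a
ifz (suc _) a b = b

ifzᶠ : CFun 3
ifzᶠ = recursion (term λ a b → a) (term λ n r a b → b) ifz (λ _ _ → refl) (λ _ _ _ → refl)

predᶠ : CFun 1
predᶠ = recursion (term (num 0)) (term λ n r → n) pred refl (λ _ → refl)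

addᶠ : CFun 2
addᶠ = recursion (term λ b → b) (term λ n r b → call succᶠ r) _+_ (λ _ → refl) (λ _ _ → refl)

monusᶠ : CFun 2
monusᶠ = compute (λ a b → call monusFlippedᶠ b a) _∸_ (λ _ _ → refl)
  where
  monusFlippedᶠ : CFun 2
  monusFlippedᶠ = recursion (term λ a → a) (term λ n r a → call predᶠ r) (λ b a → a ∸ b)
    (λ _ → refl) (λ b a → pred[m∸n]≡m∸[1+n] a b)

triᶠ : CFun 1
triᶠ = recursion (term (num 0)) (term λ n r → call addᶠ (call succᶠ n) r) tri refl (λ _ → refl)

pairᶠ : CFun 2
pairᶠ = compute (λ a b → call addᶠ (call triᶠ (call addᶠ a b)) b) pair (λ _ _ → refl)

χ-≟ : ∀ a b → ifz ((a ∸ b) + (b ∸ a)) 1 0 ≡ χ (does (a ≟ b))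
χ-≟ zero    zero    = refl
χ-≟ zero    (suc b) = refl
χ-≟ (suc a) zero    = refl
χ-≟ (suc a) (suc b) = χ-≟ a b

eqᶠ : CFun 2
eqᶠ = compute (λ a b → call ifzᶠ (call addᶠ (call monusᶠ a b) (call monusᶠ b a)) (num 1) (num 0))
  (λ a b → χ (does (a ≟ b))) χ-≟

ifz-χ : ∀ b (x y : ℕ) → ifz (χ b) y x ≡ (if b then x else y)
ifz-χ false x y = refl
ifz-χ true  x y = refl

χ-not : ∀ b → ifz (χ b) 1 0 ≡ χ (not b)
χ-not false = refl
χ-not true  = refl

χ-∧ : ∀ a b → ifz (χ a) 0 (χ b) ≡ χ (a ∧ b)
χ-∧ false b = refl
χ-∧ true  b = refl

χ-∨ : ∀ a b → ifz (χ a) (χ b) 1 ≡ χ (a ∨ b)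
χ-∨ false b = refl
χ-∨ true  b = refl

notᶠ : CFun 1
notᶠ = term λ x → call ifzᶠ x (num 1) (num 0)

andᶠ : CFun 2
andᶠ = term λ x y → call ifzᶠ x (num 0) y

orᶠ : CFun 2
orᶠ = term λ x y → call ifzᶠ x y (num 1)

diagonal : ℕ → ℕ
diagonal zero    = 0
diagonal (suc n) = if does (tri (suc (diagonal n)) ≟ suc n) then suc (diagonal n) else diagonal n

diagonalᶠ : CFun 1
diagonalᶠ = recursion (term (num 0))
  (term λ n d → call ifzᶠ (call eqᶠ (call triᶠ (call succᶠ d)) (call succᶠ n)) d (call succᶠ d))
  diagonal refl (λ n → ifz-χ (does (tri (suc (diagonal n)) ≟ suc n)) _ _)

tri-mono : ∀ {a b} → a ≤ b → tri a ≤ tri b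
tri-mono {zero}          _         = z≤n
tri-mono {suc a} {suc b} (s≤s a≤b) = +-mono-≤ (s≤s a≤b) (tri-mono a≤b)

diagonal-bounds : ∀ n → tri (diagonal n) ≤ n × n < tri (suc (diagonal n))
diagonal-bounds zero    = z≤n , s≤s z≤n
diagonal-bounds (suc n) = if-dec (λ d → tri d ≤ suc n × suc n < tri (suc d)) (tri (suc d) ≟ suc n)
  (λ tri≡ → ≤-reflexive tri≡ ,
             subst (λ t → suc t ≤ suc (suc d) + tri (suc d)) tri≡ (s≤s (m≤n+m _ (suc d))))
  (λ tri≢ → m≤n⇒m≤1+n lo , ≤∧≢⇒< hi (λ e → tri≢ (sym e)))
  where
  d = diagonal n
  lo = proj₁ (diagonal-bounds n)
  hi = proj₂ (diagonal-bounds n)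

diagonal-unique : ∀ {d e n} → tri d ≤ n → n < tri (suc d) → tri e ≤ n → n < tri (suc e) → d ≡ e
diagonal-unique {d} {e} lo₁ hi₁ lo₂ hi₂ with <-cmp d e
... | tri< d<e _ _ = ⊥-elim (<-irrefl refl (<-≤-trans hi₁ (≤-trans (tri-mono d<e) lo₂)))
... | tri≈ _ d≡e _ = d≡e
... | tri> _ _ e<d = ⊥-elim (<-irrefl refl (<-≤-trans hi₂ (≤-trans (tri-mono e<d) lo₁)))

diagonal-pair : ∀ a b → diagonal (pair a b) ≡ a + b
diagonal-pair a b = sym (diagonal-unique (m≤m+n (tri (a + b)) b) below (proj₁ bounds) (proj₂ bounds))
  where
  bounds = diagonal-bounds (pair a b)
  below : pair a b < tri (suc (a + b))
  below = subst (_< suc (a + b) + tri (a + b)) (+-comm b (tri (a + b)))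
                (+-monoˡ-< (tri (a + b)) (s≤s (m≤n+m b a)))

-- Opaque, so that machine states built with ⟪_,_⟫ stay small terms, taken apart only by the
-- projection laws π₁-⟪⟫ and π₂-⟪⟫.
opaque
  ⟪_,_⟫ : ℕ → ℕ → ℕ
  ⟪ a , b ⟫ = pair a b

  π₂ : ℕ → ℕ
  π₂ n = n ∸ tri (diagonal n)

  π₁ : ℕ → ℕ
  π₁ n = diagonal n ∸ π₂ n

  pair≡⟪⟫ : ∀ a b → pair a b ≡ ⟪ a , b ⟫
  pair≡⟪⟫ a b = refl

  π₂-def : ∀ n → n ∸ tri (diagonal n) ≡ π₂ n
  π₂-def n = refl

  π₁-def : ∀ n → diagonal n ∸ π₂ n ≡ π₁ n
  π₁-def n = refl

  π₂-⟪⟫ : ∀ a b → π₂ ⟪ a , b ⟫ ≡ b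
  π₂-⟪⟫ a b rewrite diagonal-pair a b = m+n∸m≡n (tri (a + b)) b

  π₁-⟪⟫ : ∀ a b → π₁ ⟪ a , b ⟫ ≡ a
  π₁-⟪⟫ a b rewrite π₂-⟪⟫ a b | diagonal-pair a b = m+n∸n≡m a b

  π₂-0 : π₂ 0 ≡ 0
  π₂-0 = refl

⟪⟫ᶠ : CFun 2
⟪⟫ᶠ = realise pairᶠ ⟪_,_⟫ pair≡⟪⟫

π₂ᶠ : CFun 1
π₂ᶠ = compute (λ n → call monusᶠ n (call triᶠ (call diagonalᶠ n))) π₂ π₂-def

π₁ᶠ : CFun 1
π₁ᶠ = compute (λ n → call monusᶠ (call diagonalᶠ n) (call π₂ᶠ n)) π₁ π₁-def

cons : ℕ → ℕ → ℕ
cons x l = suc ⟪ x , l ⟫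

encode : List ℕ → ℕ
encode []       = 0
encode (x ∷ xs) = cons x (encode xs)

hd : ℕ → ℕ
hd l = π₁ (pred l)

tl : ℕ → ℕ
tl l = π₂ (pred l)

hd-cons : ∀ x l → hd (cons x l) ≡ x
hd-cons = π₁-⟪⟫

tl-cons : ∀ x l → tl (cons x l) ≡ l
tl-cons = π₂-⟪⟫

tails : ℕ → ℕ → ℕ
tails zero    l = l
tails (suc k) l = tl (tails k l)

index : ℕ → ℕ → ℕ
index l i = hd (tails i l)

tails-tl : ∀ k l → tails k (tl l) ≡ tl (tails k l)
tails-tl zero    l = refl
tails-tl (suc k) l = cong tl (tails-tl k l)

tails-cons : ∀ k x l → tails (suc k) (cons x l) ≡ tails k l
tails-cons k x l = trans (sym (tails-tl k (cons x l))) (cong (tails k) (tl-cons x l))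

index-encode : ∀ xs i {x} → nth xs i ≡ just x → index (encode xs) i ≡ x
index-encode (y ∷ xs) zero    refl = hd-cons y (encode xs)
index-encode (y ∷ xs) (suc i) eq   = trans (cong hd (tails-cons i y (encode xs))) (index-encode xs i eq)

consᶠ : CFun 2
consᶠ = compute (λ x l → call succᶠ (call ⟪⟫ᶠ x l)) cons (λ _ _ → refl)

hdᶠ : CFun 1
hdᶠ = compute (λ l → call π₁ᶠ (call predᶠ l)) hd (λ _ → refl)

tlᶠ : CFun 1
tlᶠ = compute (λ l → call π₂ᶠ (call predᶠ l)) tl (λ _ → refl)

tailsᶠ : CFun 2
tailsᶠ = recursion (term λ l → l) (term λ k r l → call tlᶠ r) tails (λ _ → refl) (λ _ _ → refl)

indexᶠ : CFun 2
indexᶠ = compute (λ l i → call hdᶠ (call tailsᶠ i l)) index (λ _ _ → refl)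

allBelow : ℕ → (ℕ → Bool) → Bool
allBelow zero    q = true
allBelow (suc n) q = allBelow n q ∧ q n

anyBelow : ℕ → (ℕ → Bool) → Bool
anyBelow zero    q = false
anyBelow (suc n) q = anyBelow n q ∨ q n

allBelow-cong : ∀ n {q q′} → (∀ k → q k ≡ q′ k) → allBelow n q ≡ allBelow n q′
allBelow-cong zero    q≗q′ = refl
allBelow-cong (suc n) q≗q′ = cong₂ _∧_ (allBelow-cong n q≗q′) (q≗q′ n)

anyBelow-cong : ∀ n {q q′} → (∀ k → q k ≡ q′ k) → anyBelow n q ≡ anyBelow n q′
anyBelow-cong zero    q≗q′ = refl
anyBelow-cong (suc n) q≗q′ = cong₂ _∨_ (anyBelow-cong n q≗q′) (q≗q′ n)

allBelow-suc : ∀ n q → allBelow (suc n) q ≡ q 0 ∧ allBelow n (q ∘ suc)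
allBelow-suc zero    q = sym (∧-identityʳ (q 0))
allBelow-suc (suc n) q = trans (cong (_∧ q (suc n)) (allBelow-suc n q)) (∧-assoc (q 0) _ _)

anyBelow-suc : ∀ n q → anyBelow (suc n) q ≡ q 0 ∨ anyBelow n (q ∘ suc)
anyBelow-suc zero    q = sym (∨-identityʳ (q 0))
anyBelow-suc (suc n) q = trans (cong (_∨ q (suc n)) (anyBelow-suc n q)) (∨-assoc (q 0) _ _)

allBelow-true : ∀ n {q} → (∀ k → q k ≡ true) → allBelow n q ≡ true
allBelow-true zero    _      = refl
allBelow-true (suc n) q≡true = cong₂ _∧_ (allBelow-true n q≡true) (q≡true n)

anyBelow-false : ∀ n {q} → (∀ k → q k ≡ false) → anyBelow n q ≡ false
anyBelow-false zero    _       = refl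
anyBelow-false (suc n) q≡false = cong₂ _∨_ (anyBelow-false n q≡false) (q≡false n)

tails-0 : ∀ k → tails k 0 ≡ 0
tails-0 zero    = refl
tails-0 (suc k) = trans (cong tl (tails-0 k)) π₂-0

encEdges-cons : ∀ a b E → encEdges ((a , b) ∷ E) ≡ cons ⟪ a , b ⟫ (encEdges E)
encEdges-cons a b E = cong suc (trans (cong (λ c → pair c (encEdges E)) (pair≡⟪⟫ a b)) (pair≡⟪⟫ _ _))

length≤encEdges : ∀ E → length E ≤ encEdges E
length≤encEdges []            = z≤n
length≤encEdges ((a , b) ∷ E) = s≤s (≤-trans (length≤encEdges E) (m≤n+m (encEdges E) _))

headTest : (ℕ → ℕ → Bool) → ℕ → Bool
headTest q l = q (π₁ (hd l)) (π₂ (hd l))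

headTest-cons : ∀ q a b l → headTest q (cons ⟪ a , b ⟫ l) ≡ q a b
headTest-cons q a b l =
  cong₂ q (trans (cong π₁ (hd-cons _ l)) (π₁-⟪⟫ a b)) (trans (cong π₂ (hd-cons _ l)) (π₂-⟪⟫ a b))

emptyOr : (ℕ → ℕ → Bool) → ℕ → Bool
emptyOr q l = does (l ≟ 0) ∨ headTest q l

nonemptyAnd : (ℕ → ℕ → Bool) → ℕ → Bool
nonemptyAnd q l = not (does (l ≟ 0)) ∧ headTest q l

-- A list has at most as many elements as its code, so the first l tails of l cover it.
allEdges : (ℕ → ℕ → Bool) → ℕ → Bool
allEdges q l = allBelow l λ k → emptyOr q (tails k l)

anyEdges : (ℕ → ℕ → Bool) → ℕ → Bool
anyEdges q l = anyBelow l λ k → nonemptyAnd q (tails k l)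

module _ (q : ℕ → ℕ → Bool) where

  private
    tails-encEdges : ∀ a b E k → tails (suc k) (encEdges ((a , b) ∷ E)) ≡ tails k (encEdges E)
    tails-encEdges a b E k = trans (cong (tails (suc k)) (encEdges-cons a b E)) (tails-cons k _ _)

    headTest-encEdges : ∀ a b E → headTest q (encEdges ((a , b) ∷ E)) ≡ q a b
    headTest-encEdges a b E = trans (cong (headTest q) (encEdges-cons a b E)) (headTest-cons q a b _)

  allEdges-bounded : ∀ E f → length E ≤ f →
                     allBelow f (λ k → emptyOr q (tails k (encEdges E))) ≡ all (uncurry q) E
  allEdges-bounded []            f       _            = allBelow-true f λ k → cong (emptyOr q) (tails-0 k)
  allEdges-bounded ((a , b) ∷ E) (suc f) (s≤s length≤f) =
    trans (allBelow-suc f _)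
      (cong₂ _∧_ (headTest-encEdges a b E)
        (trans (allBelow-cong f λ k → cong (emptyOr q) (tails-encEdges a b E k)) (allEdges-bounded E f length≤f)))

  anyEdges-bounded : ∀ E f → length E ≤ f →
                     anyBelow f (λ k → nonemptyAnd q (tails k (encEdges E))) ≡ any (uncurry q) E
  anyEdges-bounded []            f       _            = anyBelow-false f λ k → cong (nonemptyAnd q) (tails-0 k)
  anyEdges-bounded ((a , b) ∷ E) (suc f) (s≤s length≤f) =
    trans (anyBelow-suc f _)
      (cong₂ _∨_ (headTest-encEdges a b E)
        (trans (anyBelow-cong f λ k → cong (nonemptyAnd q) (tails-encEdges a b E k)) (anyEdges-bounded E f length≤f)))

  allEdges-encEdges : ∀ E → allEdges q (encEdges E) ≡ all (uncurry q) E
  allEdges-encEdges E = allEdges-bounded E (encEdges E) (length≤encEdges E)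

  anyEdges-encEdges : ∀ E → anyEdges q (encEdges E) ≡ any (uncurry q) E
  anyEdges-encEdges E = anyEdges-bounded E (encEdges E) (length≤encEdges E)

module _ (Q : CFun 3) (q : ℕ → ℕ → ℕ → Bool)
         (Q-χ : ∀ e a b → fun Q (e ∷ᵛ a ∷ᵛ b ∷ᵛ []ᵛ) ≡ χ (q e a b)) where

  private
    headQ : ∀ {n} → Term n → Term n → Term n
    headQ e t = call Q e (call π₁ᶠ (call hdᶠ t)) (call π₂ᶠ (call hdᶠ t))

  allEdgesᶠ : CFun 2
  allEdgesᶠ = compute (λ e l → call belowᶠ l e l) (λ e l → χ (allEdges (q e) l)) (λ _ _ → refl)
    where
    belowᶠ : CFun 3
    belowᶠ = recursion (term λ e l → num 1)
      (term λ k r e l → call andᶠ r (call orᶠ (call eqᶠ (call tailsᶠ k l) (num 0)) (headQ e (call tailsᶠ k l))))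
      (λ n e l → χ (allBelow n λ k → emptyOr (q e) (tails k l)))
      (λ _ _ → refl)
      λ n e l → let A = allBelow n λ k → emptyOr (q e) (tails k l)
                    D = does (tails n l ≟ 0)
                    t = tails n l in
        trans (cong (λ x → ifz (χ A) 0 (ifz (χ D) x 1)) (Q-χ e (π₁ (hd t)) (π₂ (hd t))))
          (trans (cong (ifz (χ A) 0) (χ-∨ D (headTest (q e) t))) (χ-∧ A (D ∨ headTest (q e) t)))

  anyEdgesᶠ : CFun 2
  anyEdgesᶠ = compute (λ e l → call belowᶠ l e l) (λ e l → χ (anyEdges (q e) l)) (λ _ _ → refl)
    where
    belowᶠ : CFun 3
    belowᶠ = recursion (term λ e l → num 0)
      (term λ k r e l → call orᶠ r
        (call andᶠ (call notᶠ (call eqᶠ (call tailsᶠ k l) (num 0))) (headQ e (call tailsᶠ k l))))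
      (λ n e l → χ (anyBelow n λ k → nonemptyAnd (q e) (tails k l)))
      (λ _ _ → refl)
      λ n e l → let A = anyBelow n λ k → nonemptyAnd (q e) (tails k l)
                    D = does (tails n l ≟ 0)
                    t = tails n l in
        trans (cong₂ (λ x y → ifz (χ A) (ifz x 0 y) 1) (χ-not D) (Q-χ e (π₁ (hd t)) (π₂ (hd t))))
          (trans (cong (λ x → ifz (χ A) x 1) (χ-∧ (not D) (headTest (q e) t)))
                 (χ-∨ A (not D ∧ headTest (q e) t)))

-- A universal machine

-- The argument codes of a composition are stored in reverse order: the machine runs them last
-- to first and conses each value onto an accumulator, which thus ends up in the right order.
mutual
  ⌜_⌝ : Code → ℕ
  ⌜ zeroᶜ ⌝      = ⟪ 0 , 0 ⟫
  ⌜ succᶜ ⌝      = ⟪ 1 , 0 ⟫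
  ⌜ projᶜ i ⌝    = ⟪ 2 , i ⟫
  ⌜ compᶜ f gs ⌝ = ⟪ 3 , ⟪ ⌜ f ⌝ , encode (reverse ⌜ gs ⌝*) ⟫ ⟫
  ⌜ precᶜ f g ⌝  = ⟪ 4 , ⟪ ⌜ f ⌝ , ⌜ g ⌝ ⟫ ⟫
  ⌜ minᶜ f ⌝     = ⟪ 5 , ⌜ f ⌝ ⟫

  ⌜_⌝* : List Code → List ℕ
  ⌜ [] ⌝*     = []
  ⌜ g ∷ gs ⌝* = ⌜ g ⌝ ∷ ⌜ gs ⌝*

-- A state either runs a code on an (encoded) argument list or returns a value; both carry a
-- stack of frames, recording what remains to be done in a composition, a primitive recursion
-- or a minimisation. A state returning to the empty stack has halted.
evaluating : ℕ → ℕ → ℕ → ℕ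
evaluating c xs k = ⟪ 0 , ⟪ c , ⟪ xs , k ⟫ ⟫ ⟫

returning : ℕ → ℕ → ℕ
returning v k = ⟪ 1 , ⟪ v , k ⟫ ⟫

compFrame : ℕ → ℕ → ℕ → ℕ → ℕ
compFrame f gs xs acc = ⟪ 0 , ⟪ f , ⟪ gs , ⟪ xs , acc ⟫ ⟫ ⟫ ⟫

recFrame : ℕ → ℕ → ℕ → ℕ → ℕ
recFrame g i n xs = ⟪ 1 , ⟪ g , ⟪ i , ⟪ n , xs ⟫ ⟫ ⟫ ⟫

minFrame : ℕ → ℕ → ℕ → ℕ
minFrame f z xs = ⟪ 2 , ⟪ f , ⟪ z , xs ⟫ ⟫ ⟫

nextArg : ℕ → ℕ → ℕ → ℕ → ℕ → ℕ
nextArg f zero    xs acc k = evaluating f acc k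
nextArg f (suc p) xs acc k = evaluating (π₁ p) xs (cons (compFrame f (π₂ p) xs acc) k)

evalCode : ℕ → ℕ → ℕ → ℕ → ℕ
evalCode 0 _ xs k = returning 0 k
evalCode 1 _ xs k = returning (suc (hd xs)) k
evalCode 2 i xs k = returning (index xs i) k
evalCode 3 a xs k = nextArg (π₁ a) (π₂ a) xs 0 k
evalCode 4 a xs k = evaluating (π₁ a) (tl xs) (cons (recFrame (π₂ a) 0 (hd xs) (tl xs)) k)
evalCode _ f xs k = evaluating f (cons 0 xs) (cons (minFrame f 0 xs) k)

recResume : ℕ → ℕ → ℕ → ℕ → ℕ → ℕ → ℕ
recResume v g i n xs k =
  if does (i ≟ n) then returning v k else evaluating g (cons i (cons v xs)) (cons (recFrame g (suc i) n xs) k)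

minResume : ℕ → ℕ → ℕ → ℕ → ℕ → ℕ
minResume zero    f z xs k = returning z k
minResume (suc _) f z xs k = evaluating f (cons (suc z) xs) (cons (minFrame f (suc z) xs) k)

resume : ℕ → ℕ → ℕ → ℕ → ℕ
resume 0 v b k = nextArg (π₁ b) (π₁ (π₂ b)) (π₁ (π₂ (π₂ b))) (cons v (π₂ (π₂ (π₂ b)))) k
resume 1 v b k = recResume v (π₁ b) (π₁ (π₂ b)) (π₁ (π₂ (π₂ b))) (π₂ (π₂ (π₂ b))) k
resume _ v b k = minResume v (π₁ b) (π₁ (π₂ b)) (π₂ (π₂ b)) k

deliver : ℕ → ℕ → ℕ
deliver v zero    = returning v 0
deliver v (suc p) = resume (π₁ (π₁ p)) v (π₂ (π₁ p)) (π₂ p)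

advanceWith : ℕ → ℕ → ℕ
advanceWith zero    p = evalCode (π₁ (π₁ p)) (π₂ (π₁ p)) (π₁ (π₂ p)) (π₂ (π₂ p))
advanceWith (suc _) p = deliver (π₁ p) (π₂ p)

advance : ℕ → ℕ
advance s = advanceWith (π₁ s) (π₂ s)

run : ℕ → ℕ → ℕ
run zero    s = s
run (suc n) s = advance (run n s)

evaluatingᶠ : CFun 3
evaluatingᶠ = compute (λ c xs k → call ⟪⟫ᶠ (num 0) (call ⟪⟫ᶠ c (call ⟪⟫ᶠ xs k)))
  evaluating (λ _ _ _ → refl)

returningᶠ : CFun 2
returningᶠ = compute (λ v k → call ⟪⟫ᶠ (num 1) (call ⟪⟫ᶠ v k)) returning (λ _ _ → refl)

compFrameᶠ : CFun 4
compFrameᶠ = compute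
  (λ f gs xs acc → call ⟪⟫ᶠ (num 0) (call ⟪⟫ᶠ f (call ⟪⟫ᶠ gs (call ⟪⟫ᶠ xs acc))))
  compFrame (λ _ _ _ _ → refl)

recFrameᶠ : CFun 4
recFrameᶠ = compute (λ g i n xs → call ⟪⟫ᶠ (num 1) (call ⟪⟫ᶠ g (call ⟪⟫ᶠ i (call ⟪⟫ᶠ n xs))))
  recFrame (λ _ _ _ _ → refl)

minFrameᶠ : CFun 3
minFrameᶠ = compute (λ f z xs → call ⟪⟫ᶠ (num 2) (call ⟪⟫ᶠ f (call ⟪⟫ᶠ z xs)))
  minFrame (λ _ _ _ → refl)

nextArgᶠ : CFun 5
nextArgᶠ = compute
  (λ f gs xs acc k → call ifzᶠ gs (call evaluatingᶠ f acc k)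
    (call evaluatingᶠ (call π₁ᶠ (call predᶠ gs)) xs
      (call consᶠ (call compFrameᶠ f (call π₂ᶠ (call predᶠ gs)) xs acc) k)))
  nextArg λ { f zero xs acc k → refl ; f (suc p) xs acc k → refl }

evalCodeᶠ : CFun 4
evalCodeᶠ = compute
  (λ t a xs k → call ifzᶠ t (call returningᶠ (num 0) k)
    (call ifzᶠ (call monusᶠ t (num 1)) (call returningᶠ (call succᶠ (call hdᶠ xs)) k)
    (call ifzᶠ (call monusᶠ t (num 2)) (call returningᶠ (call indexᶠ xs a) k)
    (call ifzᶠ (call monusᶠ t (num 3)) (call nextArgᶠ (call π₁ᶠ a) (call π₂ᶠ a) xs (num 0) k)
    (call ifzᶠ (call monusᶠ t (num 4))
      (call evaluatingᶠ (call π₁ᶠ a) (call tlᶠ xs)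
        (call consᶠ (call recFrameᶠ (call π₂ᶠ a) (num 0) (call hdᶠ xs) (call tlᶠ xs)) k))
      (call evaluatingᶠ a (call consᶠ (num 0) xs) (call consᶠ (call minFrameᶠ a (num 0) xs) k)))))))
  evalCode λ { 0 a xs k → refl ; 1 a xs k → refl ; 2 a xs k → refl ; 3 a xs k → refl ; 4 a xs k → refl
             ; (suc (suc (suc (suc (suc t))))) a xs k → refl }

recResumeᶠ : CFun 6
recResumeᶠ = compute
  (λ v g i n xs k → call ifzᶠ (call eqᶠ i n)
    (call evaluatingᶠ g (call consᶠ i (call consᶠ v xs)) (call consᶠ (call recFrameᶠ g (call succᶠ i) n xs) k))
    (call returningᶠ v k))
  recResume (λ v g i n xs k → ifz-χ (does (i ≟ n)) _ _)

minResumeᶠ : CFun 5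
minResumeᶠ = compute
  (λ v f z xs k → call ifzᶠ v (call returningᶠ z k)
    (call evaluatingᶠ f (call consᶠ (call succᶠ z) xs) (call consᶠ (call minFrameᶠ f (call succᶠ z) xs) k)))
  minResume λ { zero f z xs k → refl ; (suc v) f z xs k → refl }

resumeᶠ : CFun 4
resumeᶠ = compute
  (λ t v b k → call ifzᶠ t
    (call nextArgᶠ (call π₁ᶠ b) (call π₁ᶠ (call π₂ᶠ b)) (call π₁ᶠ (call π₂ᶠ (call π₂ᶠ b)))
      (call consᶠ v (call π₂ᶠ (call π₂ᶠ (call π₂ᶠ b)))) k)
    (call ifzᶠ (call monusᶠ t (num 1))
      (call recResumeᶠ v (call π₁ᶠ b) (call π₁ᶠ (call π₂ᶠ b)) (call π₁ᶠ (call π₂ᶠ (call π₂ᶠ b)))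
        (call π₂ᶠ (call π₂ᶠ (call π₂ᶠ b))) k)
      (call minResumeᶠ v (call π₁ᶠ b) (call π₁ᶠ (call π₂ᶠ b)) (call π₂ᶠ (call π₂ᶠ b)) k)))
  resume λ { 0 v b k → refl ; 1 v b k → refl ; (suc (suc t)) v b k → refl }

deliverᶠ : CFun 2
deliverᶠ = compute
  (λ v k → call ifzᶠ k (call returningᶠ v (num 0))
    (call resumeᶠ (call π₁ᶠ (call π₁ᶠ (call predᶠ k))) v (call π₂ᶠ (call π₁ᶠ (call predᶠ k)))
      (call π₂ᶠ (call predᶠ k))))
  deliver λ { v zero → refl ; v (suc p) → refl }

advanceᶠ : CFun 1
advanceᶠ = compute (λ s → call advanceWithᶠ (call π₁ᶠ s) (call π₂ᶠ s)) advance (λ _ → refl)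
  where
  advanceWithᶠ : CFun 2
  advanceWithᶠ = compute
    (λ t p → call ifzᶠ t
      (call evalCodeᶠ (call π₁ᶠ (call π₁ᶠ p)) (call π₂ᶠ (call π₁ᶠ p))
                      (call π₁ᶠ (call π₂ᶠ p)) (call π₂ᶠ (call π₂ᶠ p)))
      (call deliverᶠ (call π₁ᶠ p) (call π₂ᶠ p)))
    advanceWith λ { zero p → refl ; (suc t) p → refl }

runᶠ : CFun 2
runᶠ = recursion (term λ s → s) (term λ n r s → call advanceᶠ r) run (λ _ → refl) (λ _ _ → refl)

advance-evaluating : ∀ t a xs k → advance (evaluating ⟪ t , a ⟫ xs k) ≡ evalCode t a xs k
advance-evaluating t a xs k
  rewrite π₁-⟪⟫ 0 ⟪ ⟪ t , a ⟫ , ⟪ xs , k ⟫ ⟫ | π₂-⟪⟫ 0 ⟪ ⟪ t , a ⟫ , ⟪ xs , k ⟫ ⟫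
        | π₁-⟪⟫ ⟪ t , a ⟫ ⟪ xs , k ⟫ | π₂-⟪⟫ ⟪ t , a ⟫ ⟪ xs , k ⟫
        | π₁-⟪⟫ t a | π₂-⟪⟫ t a | π₁-⟪⟫ xs k | π₂-⟪⟫ xs k = refl

advance-returning : ∀ v t b k → advance (returning v (cons ⟪ t , b ⟫ k)) ≡ resume t v b k
advance-returning v t b k
  rewrite π₁-⟪⟫ 1 ⟪ v , cons ⟪ t , b ⟫ k ⟫ | π₂-⟪⟫ 1 ⟪ v , cons ⟪ t , b ⟫ k ⟫
        | π₁-⟪⟫ v (cons ⟪ t , b ⟫ k) | π₂-⟪⟫ v (cons ⟪ t , b ⟫ k)
        | π₁-⟪⟫ ⟪ t , b ⟫ k | π₂-⟪⟫ ⟪ t , b ⟫ k | π₁-⟪⟫ t b | π₂-⟪⟫ t b = refl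

advance-halted : ∀ v → advance (returning v 0) ≡ returning v 0
advance-halted v
  rewrite π₁-⟪⟫ 1 ⟪ v , 0 ⟫ | π₂-⟪⟫ 1 ⟪ v , 0 ⟫ | π₁-⟪⟫ v 0 | π₂-⟪⟫ v 0 = refl

advance-compFrame : ∀ v f gs xs acc k →
  advance (returning v (cons (compFrame f gs xs acc) k)) ≡ nextArg f gs xs (cons v acc) k
advance-compFrame v f gs xs acc k rewrite advance-returning v 0 ⟪ f , ⟪ gs , ⟪ xs , acc ⟫ ⟫ ⟫ k
  | π₁-⟪⟫ f ⟪ gs , ⟪ xs , acc ⟫ ⟫ | π₂-⟪⟫ f ⟪ gs , ⟪ xs , acc ⟫ ⟫
  | π₁-⟪⟫ gs ⟪ xs , acc ⟫ | π₂-⟪⟫ gs ⟪ xs , acc ⟫ | π₁-⟪⟫ xs acc | π₂-⟪⟫ xs acc = refl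

advance-recFrame : ∀ v g i n xs k →
  advance (returning v (cons (recFrame g i n xs) k)) ≡ recResume v g i n xs k
advance-recFrame v g i n xs k rewrite advance-returning v 1 ⟪ g , ⟪ i , ⟪ n , xs ⟫ ⟫ ⟫ k
  | π₁-⟪⟫ g ⟪ i , ⟪ n , xs ⟫ ⟫ | π₂-⟪⟫ g ⟪ i , ⟪ n , xs ⟫ ⟫
  | π₁-⟪⟫ i ⟪ n , xs ⟫ | π₂-⟪⟫ i ⟪ n , xs ⟫ | π₁-⟪⟫ n xs | π₂-⟪⟫ n xs = refl

advance-minFrame : ∀ v f z xs k →
  advance (returning v (cons (minFrame f z xs) k)) ≡ minResume v f z xs k
advance-minFrame v f z xs k rewrite advance-returning v 2 ⟪ f , ⟪ z , xs ⟫ ⟫ k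
  | π₁-⟪⟫ f ⟪ z , xs ⟫ | π₂-⟪⟫ f ⟪ z , xs ⟫ | π₁-⟪⟫ z xs | π₂-⟪⟫ z xs = refl

nextArg-cons : ∀ f g gs xs acc k →
  nextArg f (cons g gs) xs acc k ≡ evaluating g xs (cons (compFrame f gs xs acc) k)
nextArg-cons f g gs xs acc k rewrite π₁-⟪⟫ g gs | π₂-⟪⟫ g gs = refl

recResume-done : ∀ v g n xs k → recResume v g n n xs k ≡ returning v k
recResume-done v g n xs k = if-dec (_≡ returning v k) (n ≟ n) (λ _ → refl) (λ n≢n → ⊥-elim (n≢n refl))

recResume-next : ∀ v g {i n} xs k → i < n →
  recResume v g i n xs k ≡ evaluating g (cons i (cons v xs)) (cons (recFrame g (suc i) n xs) k)
recResume-next v g {i} {n} xs k i<n =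
  if-dec (_≡ evaluating g (cons i (cons v xs)) (cons (recFrame g (suc i) n xs) k)) (i ≟ n)
    (λ i≡n → ⊥-elim (<-irrefl i≡n i<n)) (λ _ → refl)

_↠_ : ℕ → ℕ → Set
_↠_ = Star (λ s t → advance s ≡ t)

Computes : ℕ → ℕ → ℕ → Set
Computes c xs y = ∀ k → evaluating c xs k ↠ returning y k

arguments↠ : ∀ {f xs k gs vs} acc → Pointwise (λ g v → Computes g xs v) gs vs →
             nextArg f (encode gs) xs (encode acc) k ↠ evaluating f (encode (vs ʳ++ acc)) k
arguments↠ acc [] = ε
arguments↠ {f} {xs} {k} {g ∷ gs} {v ∷ vs} acc (g⇓v ∷ gs⇓vs) =
  subst (_↠ _) (sym (nextArg-cons f g (encode gs) xs (encode acc) k))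
        (g⇓v _ ◅◅ advance-compFrame v f (encode gs) xs (encode acc) k ◅ arguments↠ (v ∷ acc) gs⇓vs)

reverse-ʳ++-[] : ∀ (ys : List ℕ) → reverse ys ʳ++ [] ≡ ys
reverse-ʳ++-[] ys = trans (ʳ++-defn (reverse ys)) (trans (++-identityʳ _) (reverse-involutive ys))

mutual
  Eval⇒Computes : ∀ {c xs y} → Eval c xs y → Computes ⌜ c ⌝ (encode xs) y
  Eval⇒Computes {xs = xs} ev-zero k = advance-evaluating 0 0 (encode xs) k ◅ ε
  Eval⇒Computes {xs = x ∷ xs} ev-succ k =
    trans (advance-evaluating 1 0 (encode (x ∷ xs)) k) (cong (λ h → returning (suc h) k) (hd-cons x (encode xs))) ◅ ε
  Eval⇒Computes {projᶜ i} {xs} (ev-proj nth≡) k =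
    trans (advance-evaluating 2 i (encode xs) k) (cong (λ v → returning v k) (index-encode xs i nth≡)) ◅ ε
  Eval⇒Computes {compᶜ f gs} {xs} {y} (ev-comp {ys = ys} gs⇓ys f⇓y) k = begin
    evaluating ⌜ compᶜ f gs ⌝ (encode xs) k
      ⟶⟨ trans (advance-evaluating 3 _ (encode xs) k) (cong₂ (λ f′ gs′ → nextArg f′ gs′ (encode xs) 0 k)
           (π₁-⟪⟫ ⌜ f ⌝ (encode (reverse ⌜ gs ⌝*))) (π₂-⟪⟫ ⌜ f ⌝ (encode (reverse ⌜ gs ⌝*)))) ⟩
    nextArg ⌜ f ⌝ (encode (reverse ⌜ gs ⌝*)) (encode xs) (encode []) k
      ⟶*⟨ arguments↠ [] (reverse⁺ (EvalAll⇒Computes gs⇓ys)) ⟩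
    evaluating ⌜ f ⌝ (encode (reverse ys ʳ++ [])) k
      ≡⟨ cong (λ l → evaluating ⌜ f ⌝ (encode l) k) (reverse-ʳ++-[] ys) ⟩
    evaluating ⌜ f ⌝ (encode ys) k
      ⟶*⟨ Eval⇒Computes f⇓y k ⟩
    returning y k ∎
    where open StarReasoning (λ s t → advance s ≡ t)
  Eval⇒Computes {precᶜ f g} {n ∷ xs} {y} rec⇓y k = begin
    evaluating ⌜ precᶜ f g ⌝ (encode (n ∷ xs)) k
      ⟶⟨ trans (advance-evaluating 4 _ _ k) (cong₂ (λ f′ g′ → evaluating f′ _ (cons (recFrame g′ 0 _ _) k))
           (π₁-⟪⟫ ⌜ f ⌝ ⌜ g ⌝) (π₂-⟪⟫ ⌜ f ⌝ ⌜ g ⌝)) ⟩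
    evaluating ⌜ f ⌝ (tl (cons n X)) (cons (recFrame ⌜ g ⌝ 0 (hd (cons n X)) (tl (cons n X))) k)
      ≡⟨ cong₂ (λ h t → evaluating ⌜ f ⌝ t (cons (recFrame ⌜ g ⌝ 0 h t) k)) (hd-cons n X) (tl-cons n X) ⟩
    evaluating ⌜ f ⌝ X (cons (recFrame ⌜ g ⌝ 0 n X) k)
      ⟶*⟨ Recursion⇒Computes rec⇓y ≤-refl ⟩
    returning y (cons (recFrame ⌜ g ⌝ n n X) k)
      ⟶⟨ trans (advance-recFrame y ⌜ g ⌝ n n X k) (recResume-done y ⌜ g ⌝ n X k) ⟩
    returning y k ∎
    where
    open StarReasoning (λ s t → advance s ≡ t)
    X = encode xs
  Eval⇒Computes {minᶜ f} {xs} {y} (ev-min f⇓0 below) k =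
    advance-evaluating 5 ⌜ f ⌝ (encode xs) k ◅ search 0 y refl
    where
    X = encode xs
    search : ∀ z d → z + d ≡ y → evaluating ⌜ f ⌝ (cons z X) (cons (minFrame ⌜ f ⌝ z X) k) ↠ returning y k
    search z zero z+0≡y rewrite +-identityʳ z | z+0≡y =
      Eval⇒Computes f⇓0 _ ◅◅ advance-minFrame 0 ⌜ f ⌝ y X k ◅ ε
    search z (suc d) z+d≡y =
      Eval⇒Computes (proj₂ (below z z<y)) _ ◅◅
      advance-minFrame _ ⌜ f ⌝ z X k ◅ search (suc z) d (trans (sym (+-suc z d)) z+d≡y)
      where
      z<y : z < y
      z<y = subst (z <_) z+d≡y (m<m+n z (s≤s z≤n))

  EvalAll⇒Computes : ∀ {gs xs ys} → EvalAll gs xs ys → Pointwise (λ g v → Computes g (encode xs) v) ⌜ gs ⌝* ys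
  EvalAll⇒Computes []           = []
  EvalAll⇒Computes (g⇓ ∷ gs⇓) = Eval⇒Computes g⇓ ∷ EvalAll⇒Computes gs⇓

  Recursion⇒Computes : ∀ {f g i xs r n k} → Eval (precᶜ f g) (i ∷ xs) r → i ≤ n →
    evaluating ⌜ f ⌝ (encode xs) (cons (recFrame ⌜ g ⌝ 0 n (encode xs)) k) ↠
    returning r (cons (recFrame ⌜ g ⌝ i n (encode xs)) k)
  Recursion⇒Computes (ev-prec0 f⇓) _ = Eval⇒Computes f⇓ _
  Recursion⇒Computes {g = g} {suc i} {xs} {n = n} {k} (ev-precS {r = r} prev⇓ g⇓) i<n =
    Recursion⇒Computes prev⇓ (≤-trans (n≤1+n i) i<n) ◅◅
    trans (advance-recFrame r ⌜ g ⌝ i n (encode xs) k) (recResume-next r ⌜ g ⌝ (encode xs) k i<n) ◅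
    Eval⇒Computes g⇓ _

selfStart : ℕ → ℕ
selfStart e = evaluating e (encode (e ∷ [])) 0

haltsWith2 : ℕ → ℕ → Bool
haltsWith2 e j = does (run j (selfStart e) ≟ returning 2 0)

haltsWith2ᶠ : CFun 2
haltsWith2ᶠ = compute
  (λ e j → call eqᶠ (call runᶠ j (call evaluatingᶠ e (call consᶠ e (num 0)) (num 0)))
                    (call returningᶠ (num 2) (num 0)))
  (λ e j → χ (haltsWith2 e j)) (λ _ _ → refl)

run-+ : ∀ m n s → run (m + n) s ≡ run m (run n s)
run-+ zero    n s = refl
run-+ (suc m) n s = cong advance (run-+ m n s)

run-halted : ∀ m v → run m (returning v 0) ≡ returning v 0
run-halted zero    v = refl
run-halted (suc m) v = trans (cong advance (run-halted m v)) (advance-halted v)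

↠⇒run : ∀ {s t} → s ↠ t → ∃ λ n → run n s ≡ t
↠⇒run ε = 0 , refl
↠⇒run {s} (s⟶ ◅ r) with ↠⇒run r
... | n , run≡ = n + 1 , trans (run-+ n 1 s) (trans (cong (run n) s⟶) run≡)

returning-injective : ∀ {a b} → returning a 0 ≡ returning b 0 → a ≡ b
returning-injective {a} {b} eq = trans (sym (value a)) (trans (cong (λ s → π₁ (π₂ s)) eq) (value b))
  where
  value : ∀ v → π₁ (π₂ (returning v 0)) ≡ v
  value v = trans (cong π₁ (π₂-⟪⟫ 1 ⟪ v , 0 ⟫)) (π₁-⟪⟫ v 0)

haltsWith2-mono : ∀ e j → haltsWith2 e j ≡ true → haltsWith2 e (suc j) ≡ true
haltsWith2-mono e j halted = dec-true (run (suc j) (selfStart e) ≟ returning 2 0)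
  (trans (cong advance (does-true (run j (selfStart e) ≟ returning 2 0) halted)) (advance-halted 2))

haltsWith2-complete : ∀ c → Eval c (⌜ c ⌝ ∷ []) 2 → ∃ λ j → haltsWith2 ⌜ c ⌝ j ≡ true
haltsWith2-complete c c⇓2 with ↠⇒run (Eval⇒Computes c⇓2 0)
... | j , run≡ = j , dec-true (run j (selfStart ⌜ c ⌝) ≟ returning 2 0) run≡

haltsWith2-sound : ∀ c {y} → Eval c (⌜ c ⌝ ∷ []) y → ∀ j → haltsWith2 ⌜ c ⌝ j ≡ true → y ≡ 2
haltsWith2-sound c {y} c⇓y j halted with ↠⇒run (Eval⇒Computes c⇓y 0)
... | m , run≡ = returning-injective (begin
  returning y 0          ≡⟨ sym (run-halted j y) ⟩
  run j (returning y 0)  ≡⟨ cong (run j) (sym run≡) ⟩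
  run j (run m s)        ≡⟨ sym (run-+ j m s) ⟩
  run (j + m) s          ≡⟨ cong (λ n → run n s) (+-comm j m) ⟩
  run (m + j) s          ≡⟨ run-+ m j s ⟩
  run m (run j s)        ≡⟨ cong (run m) (does-true (run j s ≟ returning 2 0) halted) ⟩
  run m (returning 2 0)  ≡⟨ run-halted m 2 ⟩
  returning 2 0          ∎)
  where
  open ≡-Reasoning
  s = selfStart ⌜ c ⌝

Removed-sym : ∀ {E u v} → Removed E u v → Removed E v u
Removed-sym (inj₁ uv∈E) = inj₂ uv∈E
Removed-sym (inj₂ vu∈E) = inj₁ vu∈E

module _ {G : Graph} {E : List (ℕ × ℕ)} where

  reach-trans : ∀ {u v w} → Reach G E u v → Reach G E v w → Reach G E u w
  reach-trans u↝v here                = u↝v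
  reach-trans u↝v (step v↝w adj kept) = step (reach-trans u↝v v↝w) adj kept

  reach-sym : ∀ {u v} → Reach G E u v → Reach G E v u
  reach-sym here = here
  reach-sym {u} (step {v} {w} u↝v adj kept) =
    reach-trans (step here (trans (adj-sym G w v) adj) (kept ∘ Removed-sym)) (reach-sym u↝v)

Closed : Graph → List (ℕ × ℕ) → (ℕ → Set) → Set
Closed G E S = ∀ {u w} → S u → Adj G u w ≡ true → ¬ Removed E u w → S w

reach-closed : ∀ {G E S u w} → Closed G E S → S u → Reach G E u w → S w
reach-closed closed Su here                 = Su
reach-closed closed Su (step u↝v adj kept) = closed (reach-closed closed Su u↝v) adj kept

unbounded⇒infinite : ∀ {P : ℕ → Set} → (∀ n → ∃ λ w → n < w × P w) → ¬ Finite P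
unbounded⇒infinite unbounded (L , P⊆L) with unbounded (max 0 L)
... | w , max<w , Pw = <⇒≱ max<w (All.lookup (xs≤max 0 L) (P⊆L w Pw))

two-infinite-components : ∀ {G E} (S : ℕ → Set) {x y} → Closed G E S → S x → ¬ S y →
  V G x ≡ true → V G y ≡ true → ¬ Finite (Reach G E x) → ¬ Finite (Reach G E y) → AtLeastInfComps G E 2
two-infinite-components {G} {E} S {x} {y} closed Sx ¬Sy Vx Vy ∞x ∞y = vs , Vvs , apart , infinite
  where
  vs : Fin 2 → ℕ
  vs Fin.zero    = x
  vs (Fin.suc _) = y
  Vvs : ∀ i → V G (vs i) ≡ true
  Vvs Fin.zero    = Vx
  Vvs (Fin.suc _) = Vy
  apart : ∀ i j → i ≢ j → ¬ Reach G E (vs i) (vs j)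
  apart Fin.zero    Fin.zero    i≢j = ⊥-elim (i≢j refl)
  apart Fin.zero    (Fin.suc _) _   x↝y = ¬Sy (reach-closed closed Sx x↝y)
  apart (Fin.suc _) Fin.zero    _   y↝x = ¬Sy (reach-closed closed Sx (reach-sym y↝x))
  apart (Fin.suc Fin.zero) (Fin.suc Fin.zero) i≢j = ⊥-elim (i≢j refl)
  infinite : ∀ i → ¬ Finite (Reach G E (vs i))
  infinite Fin.zero    = ∞x
  infinite (Fin.suc _) = ∞y

EndsAtLeast-≤ : ∀ {G m n} → m ≤ n → EndsAtLeast G n → EndsAtLeast G m
EndsAtLeast-≤ m≤n (E , E⊆G , vs , Vvs , apart , infinite) =
  E , E⊆G , vs ∘ ι , Vvs ∘ ι ,
  (λ i j i≢j → apart (ι i) (ι j) (i≢j ∘ inject≤-injective m≤n m≤n i j)) , infinite ∘ ι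
  where
  ι = λ i → inject≤ i m≤n

record ParentFunction (G : Graph) : Set where
  field
    parent   : ℕ → ℕ
    depth    : ℕ → ℕ
    oriented : ∀ {u v} → Adj G u v ≡ true →
               (parent v ≡ u × depth u < depth v) ⊎ (parent u ≡ v × depth v < depth u)

-- `IsCycle` keeps its closing condition in a local definition; we name its type as the
-- codomain of the projection onto it.
closingEdge : ∀ G v₀ vs → IsCycle G v₀ vs → _
closingEdge G v₀ vs cycle = proj₂ (proj₂ (proj₂ cycle))

ClosingEdge : Graph → ℕ → List ℕ → Set
ClosingEdge G v₀ vs = Codomain (closingEdge G v₀ vs)
  where
  Codomain : ∀ {A B : Set} → (A → B) → Set
  Codomain {B = B} _ = B

module _ {G : Graph} (P : ParentFunction G) where
  open ParentFunction P

  private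
    Up : ℕ → ℕ → Set
    Up u v = parent v ≡ u × depth u < depth v

    NonBacktracking : List ℕ → Set
    NonBacktracking (a ∷ b ∷ c ∷ l) = a ≢ c × NonBacktracking (b ∷ c ∷ l)
    NonBacktracking _               = ⊤

    final : ℕ → List ℕ → ℕ
    final a []      = a
    final a (b ∷ l) = final b l

    penultimate : ℕ → ℕ → List ℕ → ℕ
    penultimate a b []      = a
    penultimate a b (c ∷ l) = penultimate b c l

    EndsUp : ℕ → List ℕ → Set
    EndsUp a []          = ⊥
    EndsUp a (b ∷ [])    = parent b ≡ a
    EndsUp a (b ∷ c ∷ l) = EndsUp b (c ∷ l)

    ascending : ∀ {a b} l → Walk G (a ∷ b ∷ l) → NonBacktracking (a ∷ b ∷ l) → Up a b →
                depth a < depth (final b l) × EndsUp a (b ∷ l)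
    ascending []      _        _           (b↑ , a<b) = a<b , b↑
    ascending (c ∷ l) (_ , bc) (a≢c , nb) (b↑ , a<b) with oriented (proj₁ bc)
    ... | inj₁ c↑       = Data.Product.map₁ (<-trans a<b) (ascending l bc nb c↑)
    ... | inj₂ (b↓ , _) = ⊥-elim (a≢c (trans (sym b↑) b↓))

    descending : ∀ {a b} l → Walk G (a ∷ b ∷ l) → NonBacktracking (a ∷ b ∷ l) → Up b a →
                 depth (final b l) < depth a ⊎ EndsUp a (b ∷ l)
    descending []      _        _          (_ , b<a) = inj₁ b<a
    descending (c ∷ l) (_ , bc) (_ , nb) (_ , b<a) with oriented (proj₁ bc)
    ... | inj₁ c↑ = inj₂ (proj₂ (ascending l bc nb c↑))
    ... | inj₂ c↓ = Data.Sum.map₁ (λ c<b → <-trans c<b b<a) (descending l bc nb c↓)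

    close-walk : ∀ v₀ x l → Walk G (x ∷ l) → ClosingEdge G v₀ (x ∷ l) → Walk G (x ∷ l ++ v₀ ∷ [])
    close-walk v₀ x []      _        x~v₀ = x~v₀ , λ ()
    close-walk v₀ x (y ∷ l) (xy , w) ends = xy , close-walk v₀ y l w ends

    close-nonBacktracking : ∀ z a b l → Unique (a ∷ b ∷ l) → penultimate a b l ≢ z →
                            NonBacktracking (a ∷ b ∷ l ++ z ∷ [])
    close-nonBacktracking z a b []      _                             pen≢z = pen≢z , tt
    close-nonBacktracking z a b (c ∷ l) ((_ ∷ a≢c ∷ _) ∷ unique) pen≢z =
      a≢c , close-nonBacktracking z b c l unique pen≢z

    penultimate-∈ : ∀ a b l → penultimate a b l ∈ a ∷ b ∷ l
    penultimate-∈ a b []      = here refl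
    penultimate-∈ a b (c ∷ l) = there (penultimate-∈ b c l)

    final-∈ : ∀ a l → final a l ∈ a ∷ l
    final-∈ a []      = here refl
    final-∈ a (b ∷ l) = there (final-∈ b l)

    final-∷ʳ : ∀ a l z → final a (l ++ z ∷ []) ≡ z
    final-∷ʳ a []      z = refl
    final-∷ʳ a (b ∷ l) z = final-∷ʳ b l z

    EndsUp-∷ʳ : ∀ a l z → EndsUp a (l ++ z ∷ []) → parent z ≡ final a l
    EndsUp-∷ʳ a []          z ends = ends
    EndsUp-∷ʳ a (b ∷ [])    z ends = ends
    EndsUp-∷ʳ a (b ∷ c ∷ l) z ends = EndsUp-∷ʳ b (c ∷ l) z ends

  acyclic : ∀ v₀ vs → ¬ IsCycle G v₀ vs
  acyclic v₀ []       (() , _)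
  acyclic v₀ (_ ∷ []) (s≤s () , _)
  acyclic v₀ (v₁ ∷ v₂ ∷ l) cycle@(_ , unique@(v₀∉ ∷ v₁∉ ∷ _) , (v₀v₁ , walk) , _) =
    impossible (oriented v₀v₁)
    where
    closed = close-walk v₀ v₁ (v₂ ∷ l) walk (closingEdge G v₀ (v₁ ∷ v₂ ∷ l) cycle)
    nb = close-nonBacktracking v₀ v₀ v₁ (v₂ ∷ l) unique
           (λ pen≡v₀ → All.lookup v₀∉ (penultimate-∈ v₁ v₂ l) (sym pen≡v₀))
    returns : depth (final v₁ (v₂ ∷ l ++ v₀ ∷ [])) ≡ depth v₀
    returns = cong depth (final-∷ʳ v₁ (v₂ ∷ l) v₀)
    impossible : Up v₀ v₁ ⊎ Up v₁ v₀ → ⊥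
    impossible (inj₁ v₁↑) =
      <-irrefl (sym returns) (proj₁ (ascending (v₂ ∷ l ++ v₀ ∷ []) (v₀v₁ , closed) nb v₁↑))
    impossible (inj₂ v₁↓) with descending (v₂ ∷ l ++ v₀ ∷ []) (v₀v₁ , closed) nb v₁↓
    ... | inj₁ v₀<v₀ = <-irrefl returns v₀<v₀
    ... | inj₂ ends  =
      All.lookup v₁∉ (final-∈ v₂ l) (trans (sym (proj₁ v₁↓)) (EndsUp-∷ʳ v₁ (v₂ ∷ l) v₀ ends))

ray : ∀ {G E} (f : ℕ → ℕ) {a b} → a ≤ b →
      (∀ {j} → a ≤ j → j < b → Adj G (f j) (f (suc j)) ≡ true × ¬ Removed E (f j) (f (suc j))) →
      Reach G E (f a) (f b)
ray f {b = zero}  z≤n _ = here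
ray f {a} {suc b} a≤1+b edges with m≤n⇒m<n∨m≡n a≤1+b
... | inj₂ refl      = here
... | inj₁ (s≤s a≤b) = step (ray f a≤b (λ a≤j j<b → edges a≤j (m≤n⇒m≤1+n j<b)))
                            (proj₁ (edges a≤b ≤-refl)) (proj₂ (edges a≤b ≤-refl))

bound : List (ℕ × ℕ) → ℕ
bound []            = 0
bound ((a , b) ∷ E) = suc (a + b + bound E)

∈⇒<bound : ∀ {E u v} → (u , v) ∈ E → u < bound E × v < bound E
∈⇒<bound {(a , b) ∷ E} (here refl) =
  s≤s (≤-trans (m≤m+n a b) (m≤m+n _ _)) , s≤s (≤-trans (m≤n+m b a) (m≤m+n _ _))
∈⇒<bound {(a , b) ∷ E} (there uv∈E) =
  Data.Product.map (λ u< → ≤-trans u< grow) (λ v< → ≤-trans v< grow) (∈⇒<bound uv∈E)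
  where grow = m≤n⇒m≤1+n (m≤n+m (bound E) (a + b))

Removed⇒<bound : ∀ {E u v} → Removed E u v → u < bound E × v < bound E
Removed⇒<bound (inj₁ uv∈E) = ∈⇒<bound uv∈E
Removed⇒<bound (inj₂ vu∈E) = Data.Product.swap (∈⇒<bound vu∈E)

beyond-bound : ∀ {E u v} → bound E ≤ u → ¬ Removed E u v
beyond-bound B≤u removed = <⇒≱ (proj₁ (Removed⇒<bound removed)) B≤u

Removed? : ∀ E u v → Dec (Removed E u v)
Removed? E u v = ((u , v) ∈? E) ⊎-dec ((v , u) ∈? E)
  where open Data.List.Membership.DecPropositional (≡-dec _≟_ _≟_) using (_∈?_)

reach-finite : ∀ {G E x y} → Reach G E x y → Finite (Reach G E y) → Finite (Reach G E x)
reach-finite x↝y (L , y-comp⊆L) = L , λ w x↝w → y-comp⊆L w (reach-trans (reach-sym x↝y) x↝w)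

ends-bound : ∀ {G j k} → EndsAtLeast G k → ¬ EndsAtLeast G (suc j) → k ≤ j
ends-bound {j = j} {k} k-ends no-more with k ≤? j
... | yes k≤j = k≤j
... | no  k≰j = ⊥-elim (no-more (EndsAtLeast-≤ (≰⇒> k≰j) k-ends))

HasEnds-functional : ∀ {G m n} → HasEnds G m → HasEnds G n → m ≡ n
HasEnds-functional {m = zero}  {zero}  _      _      = refl
HasEnds-functional {m = zero}  {suc n} all    (_ , no-more) = ⊥-elim (no-more (all (suc n)))
HasEnds-functional {m = suc m} {zero}  (_ , no-more) all    = ⊥-elim (no-more (all (suc m)))
HasEnds-functional {m = suc m} {suc n} (m-ends , m-max) (n-ends , n-max) =
  cong suc (≤-antisym (ends-bound m-ends n-max) (ends-bound n-ends m-max))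

-- The trees

odd : ℕ → Bool
odd zero    = false
odd (suc n) = not (odd n)

half : ℕ → ℕ
half zero    = 0
half (suc n) = if odd n then suc (half n) else half n

data Vertex : Set where
  trunk branch : ℕ → Vertex

⌊_⌋ : Vertex → ℕ
⌊ trunk a ⌋  = a + a
⌊ branch a ⌋ = suc (a + a)

decode : ℕ → Vertex
decode n = if odd n then branch (half n) else trunk (half n)

odd-double : ∀ a → odd (a + a) ≡ false
odd-double zero    = refl
odd-double (suc a) rewrite +-suc a a | odd-double a = refl

half-double : ∀ a → half (a + a) ≡ a
half-double zero    = refl
half-double (suc a) rewrite +-suc a a | odd-double a | half-double a = refl

decode-⌊⌋ : ∀ x → decode ⌊ x ⌋ ≡ x
decode-⌊⌋ (trunk a)  rewrite odd-double a | half-double a = refl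
decode-⌊⌋ (branch a) rewrite odd-double a | half-double a = refl

⌊⌋-decode : ∀ n → ⌊ decode n ⌋ ≡ n
⌊⌋-decode zero = refl
⌊⌋-decode (suc n) with odd n | ⌊⌋-decode n
... | true  | ⌊branch⌋≡n = cong suc (trans (+-suc (half n) (half n)) ⌊branch⌋≡n)
... | false | ⌊trunk⌋≡n  = cong suc ⌊trunk⌋≡n

⌊⌋-injective : ∀ {x y} → ⌊ x ⌋ ≡ ⌊ y ⌋ → x ≡ y
⌊⌋-injective {x} {y} eq = trans (sym (decode-⌊⌋ x)) (trans (cong decode eq) (decode-⌊⌋ y))

module Tree (h : ℕ → Bool) (h-mono : ∀ j → h j ≡ true → h (suc j) ≡ true) where

  h-mono-≤ : ∀ {i j} → i ≤ j → h i ≡ true → h j ≡ true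
  h-mono-≤ {j = zero}  z≤n   hi = hi
  h-mono-≤ {i} {suc j} i≤1+j hi with m≤n⇒m<n∨m≡n i≤1+j
  ... | inj₁ (s≤s i≤j) = h-mono j (h-mono-≤ i≤j hi)
  ... | inj₂ refl      = hi

  isFirst : ℕ → Bool
  isFirst zero    = h zero
  isFirst (suc j) = not (h j) ∧ h (suc j)

  isFirst⇒h : ∀ j → isFirst j ≡ true → h j ≡ true
  isFirst⇒h zero    first = first
  isFirst⇒h (suc j) first = proj₂ (∧-true {not (h j)} first)

  isFirst-least : ∀ {s j} → isFirst s ≡ true → h j ≡ true → s ≤ j
  isFirst-least {zero}      _     _  = z≤n
  isFirst-least {suc s} {j} first hj with suc s ≤? j
  ... | yes s<j = s<j
  ... | no  s≮j
    with trans (sym (cong not (h-mono-≤ (≤-pred (≰⇒> s≮j)) hj))) (proj₁ (∧-true {not (h s)} first))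
  ...   | ()

  isFirst-unique : ∀ {s t} → isFirst s ≡ true → isFirst t ≡ true → s ≡ t
  isFirst-unique {s} {t} fs ft = ≤-antisym (isFirst-least fs (isFirst⇒h t ft)) (isFirst-least ft (isFirst⇒h s fs))

  isFirst-suc : ∀ a → h a ≡ true → isFirst (suc a) ≡ false
  isFirst-suc a ha rewrite ha = refl

  first-≤ : ∀ a → h a ≡ true → ∃ λ s → isFirst s ≡ true × s ≤ a
  first-≤ zero    h0 = 0 , h0 , z≤n
  first-≤ (suc a) ha with h a in ha′
  ... | true  = Data.Product.map₂ (Data.Product.map₂ m≤n⇒m≤1+n) (first-≤ a ha′)
  ... | false = suc a , trans (cong (λ b → not b ∧ h (suc a)) ha′) ha , ≤-refl

  notFirst : ∀ a → h a ≡ true → isFirst a ≡ false → ∃ λ a′ → a ≡ suc a′ × h a′ ≡ true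
  notFirst zero    h0 ¬first with trans (sym h0) ¬first
  ... | ()
  notFirst (suc a) ha ¬first with h a in ha′
  ... | true  = a , refl , ha′
  ... | false with trans (sym ha) ¬first
  ...   | ()

  present : Vertex → Bool
  present (trunk _)  = true
  present (branch a) = h a

  data Link : Vertex → Vertex → Set where
    trunk-link  : ∀ a → Link (trunk a) (trunk (suc a))
    attach-link : ∀ {a} → isFirst a ≡ true → Link (trunk a) (branch a)
    branch-link : ∀ {a} → h a ≡ true → Link (branch a) (branch (suc a))

  Linked : Vertex → Vertex → Set
  Linked x y = Link x y ⊎ Link y x

  linked : Vertex → Vertex → Bool
  linked (trunk a)  (trunk b)  = does (suc a ≟ b) ∨ does (suc b ≟ a)
  linked (trunk a)  (branch b) = does (a ≟ b) ∧ isFirst a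
  linked (branch a) (trunk b)  = does (a ≟ b) ∧ isFirst b
  linked (branch a) (branch b) = (does (suc a ≟ b) ∧ h a) ∨ (does (suc b ≟ a) ∧ h b)

  linked-sound : ∀ x y → linked x y ≡ true → Linked x y
  linked-sound (trunk a) (trunk b) e with ∨-true e
  ... | inj₁ e′ with does-true (suc a ≟ b) e′
  ...   | refl = inj₁ (trunk-link a)
  linked-sound (trunk a) (trunk b) e | inj₂ e′ with does-true (suc b ≟ a) e′
  ...   | refl = inj₂ (trunk-link b)
  linked-sound (trunk a) (branch b) e with ∧-true e
  ... | a≟b , first with does-true (a ≟ b) a≟b
  ...   | refl = inj₁ (attach-link first)
  linked-sound (branch a) (trunk b) e with ∧-true e
  ... | a≟b , first with does-true (a ≟ b) a≟b
  ...   | refl = inj₂ (attach-link first)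
  linked-sound (branch a) (branch b) e with ∨-true e
  ... | inj₁ e′ with ∧-true e′
  ...   | a≟b , ha with does-true (suc a ≟ b) a≟b
  ...     | refl = inj₁ (branch-link ha)
  linked-sound (branch a) (branch b) e | inj₂ e′ with ∧-true e′
  ...   | b≟a , hb with does-true (suc b ≟ a) b≟a
  ...     | refl = inj₂ (branch-link hb)

  Link⇒linked : ∀ {x y} → Link x y → linked x y ≡ true × linked y x ≡ true
  Link⇒linked (trunk-link a) =
    cong (_∨ does (suc (suc a) ≟ a)) a+1≡a+1 ,
    trans (cong (does (suc (suc a) ≟ a) ∨_) a+1≡a+1) (∨-zeroʳ _)
    where a+1≡a+1 = dec-true (suc a ≟ suc a) refl
  Link⇒linked {trunk a} (attach-link first) rewrite dec-true (a ≟ a) refl = first , first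
  Link⇒linked {branch a} (branch-link ha) rewrite dec-true (suc a ≟ suc a) refl | ha =
    refl , ∨-zeroʳ _

  linked-complete : ∀ {x y} → Linked x y → linked x y ≡ true
  linked-complete (inj₁ x→y) = proj₁ (Link⇒linked x→y)
  linked-complete (inj₂ y→x) = proj₂ (Link⇒linked y→x)

  Linked-sym : ∀ {x y} → Linked x y → Linked y x
  Linked-sym = Data.Sum.swap

  Link-irrefl : ∀ {x} → ¬ Link x x
  Link-irrefl ()

  Link-present : ∀ {x y} → Link x y → present x ≡ true × present y ≡ true
  Link-present (trunk-link a)          = refl , refl
  Link-present (attach-link {a} first) = refl , isFirst⇒h a first
  Link-present (branch-link {a} ha)    = ha , h-mono a ha

  attachment : ℕ → List Vertex
  attachment a = if isFirst a then branch a ∷ [] else []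

  branchParent : ℕ → Vertex
  branchParent a = if isFirst a then trunk a else branch (pred a)

  neighboursᵛ : Vertex → List Vertex
  neighboursᵛ (trunk zero)    = trunk 1 ∷ attachment 0
  neighboursᵛ (trunk (suc a)) = trunk (suc (suc a)) ∷ trunk a ∷ attachment (suc a)
  neighboursᵛ (branch a)      = branch (suc a) ∷ branchParent a ∷ []

  attachment-∈ : ∀ {a y} → y ∈ attachment a → y ≡ branch a × isFirst a ≡ true
  attachment-∈ {a} y∈ with isFirst a
  attachment-∈ (here refl) | true = refl , refl

  ∈-attachment : ∀ {a} → isFirst a ≡ true → branch a ∈ attachment a
  ∈-attachment first rewrite first = here refl

  attachment-unique : ∀ a → Unique (attachment a)
  attachment-unique a with isFirst a
  ... | true  = [] ∷ []
  ... | false = []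

  ∉-attachment : ∀ {a x} → (∀ {b} → x ≢ branch b) → All.All (x ≢_) (attachment a)
  ∉-attachment {a} x≢branch with isFirst a
  ... | true  = x≢branch ∷ []
  ... | false = []

  branchParent-first : ∀ {a} → isFirst a ≡ true → branchParent a ≡ trunk a
  branchParent-first first rewrite first = refl

  branchParent-suc : ∀ {a} → h a ≡ true → branchParent (suc a) ≡ branch a
  branchParent-suc {a} ha rewrite isFirst-suc a ha = refl

  neighboursᵛ-unique : ∀ x → Unique (neighboursᵛ x)
  neighboursᵛ-unique (trunk zero) = ∉-attachment (λ ()) ∷ attachment-unique 0
  neighboursᵛ-unique (trunk (suc a)) =
    ((λ ()) ∷ ∉-attachment (λ ())) ∷ ∉-attachment (λ ()) ∷ attachment-unique (suc a)
  neighboursᵛ-unique (branch a) = (distinct ∷ []) ∷ [] ∷ []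
    where
    distinct : branch (suc a) ≢ branchParent a
    distinct with isFirst a
    ... | true  = λ ()
    ... | false = λ e → 1+n≢pred a (branch-injective e)
      where
      branch-injective : ∀ {b c} → branch b ≡ branch c → b ≡ c
      branch-injective refl = refl
      1+n≢pred : ∀ a → suc a ≢ pred a
      1+n≢pred zero    ()
      1+n≢pred (suc a) ()

  neighboursᵛ-sound : ∀ {x y} → present x ≡ true → y ∈ neighboursᵛ x → Linked x y
  neighboursᵛ-sound {trunk zero}    _ (here refl)         = inj₁ (trunk-link 0)
  neighboursᵛ-sound {trunk zero}    _ (there y∈)          with attachment-∈ y∈
  ... | refl , first = inj₁ (attach-link first)
  neighboursᵛ-sound {trunk (suc a)} _ (here refl)         = inj₁ (trunk-link (suc a))
  neighboursᵛ-sound {trunk (suc a)} _ (there (here refl)) = inj₂ (trunk-link a)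
  neighboursᵛ-sound {trunk (suc a)} _ (there (there y∈)) with attachment-∈ y∈
  ... | refl , first = inj₁ (attach-link first)
  neighboursᵛ-sound {branch a} ha (here refl) = inj₁ (branch-link ha)
  neighboursᵛ-sound {branch a} ha (there (here refl)) with isFirst a in first
  ... | true  = inj₂ (attach-link first)
  ... | false with notFirst a ha first
  ...   | a′ , refl , ha′ = inj₂ (branch-link ha′)

  neighboursᵛ-complete : ∀ {x y} → Linked x y → y ∈ neighboursᵛ x
  neighboursᵛ-complete (inj₁ (trunk-link zero))    = here refl
  neighboursᵛ-complete (inj₁ (trunk-link (suc a))) = here refl
  neighboursᵛ-complete (inj₁ (attach-link {zero} first))  = there (∈-attachment first)
  neighboursᵛ-complete (inj₁ (attach-link {suc a} first)) = there (there (∈-attachment first))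
  neighboursᵛ-complete (inj₁ (branch-link ha))     = here refl
  neighboursᵛ-complete (inj₂ (trunk-link a))       = there (here refl)
  neighboursᵛ-complete (inj₂ (attach-link first))  = there (here (sym (branchParent-first first)))
  neighboursᵛ-complete (inj₂ (branch-link ha))     = there (here (sym (branchParent-suc ha)))

  vertex : ℕ → Bool
  vertex n = present (decode n)

  adjacent : ℕ → ℕ → Bool
  adjacent u v = linked (decode u) (decode v)

  neighbours : ℕ → List ℕ
  neighbours n = map ⌊_⌋ (neighboursᵛ (decode n))

  degree : ℕ → ℕ
  degree n = length (neighbours n)

  adjacent-⌊⌋ : ∀ x y → adjacent ⌊ x ⌋ ⌊ y ⌋ ≡ linked x y
  adjacent-⌊⌋ x y = cong₂ linked (decode-⌊⌋ x) (decode-⌊⌋ y)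

  neighbours-correct : ∀ v → vertex v ≡ true →
    Σ (List ℕ) λ L → Unique L × (∀ w → (w ∈ L → adjacent v w ≡ true) × (adjacent v w ≡ true → w ∈ L))
                   × length L ≡ degree v
  neighbours-correct v present-v =
    neighbours v , Unique.map⁺ ⌊⌋-injective (neighboursᵛ-unique (decode v)) , (λ w → sound w , complete w) , refl
    where
    sound : ∀ w → w ∈ neighbours v → adjacent v w ≡ true
    sound w w∈ with ∈-map⁻ ⌊_⌋ w∈
    ... | y , y∈ , refl = trans (cong (linked (decode v)) (decode-⌊⌋ y))
                                (linked-complete (neighboursᵛ-sound present-v y∈))
    complete : ∀ w → adjacent v w ≡ true → w ∈ neighbours v
    complete w adj = subst (_∈ neighbours v) (⌊⌋-decode w)
      (∈-map⁺ ⌊_⌋ (neighboursᵛ-complete (linked-sound (decode v) (decode w) adj)))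

  tree : Graph
  tree = record
    { V       = vertex
    ; Adj     = adjacent
    ; adj-sym = λ u v → true⇔⇒≡ (flip u v) (flip v u)
    ; adj-irr = λ v → ¬-not λ adj → [ Link-irrefl , Link-irrefl ] (linked-sound (decode v) (decode v) adj)
    ; adj-V   = λ u v adj →
                  [ proj₁ ∘ Link-present , proj₂ ∘ Link-present ] (linked-sound (decode u) (decode v) adj)
    ; deg     = degree
    ; deg-ok  = neighbours-correct
    }
    where
    flip : ∀ u v → adjacent u v ≡ true → adjacent v u ≡ true
    flip u v adj = linked-complete (Linked-sym (linked-sound (decode u) (decode v) adj))

  parentᵛ : Vertex → Vertex
  parentᵛ (trunk a)  = trunk (pred a)
  parentᵛ (branch a) = branchParent a

  depthᵛ : Vertex → ℕ
  depthᵛ (trunk a)  = a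
  depthᵛ (branch a) = suc a

  Link⇒parent : ∀ {x y} → Link x y → parentᵛ y ≡ x × depthᵛ x < depthᵛ y
  Link⇒parent (trunk-link a)      = refl , ≤-refl
  Link⇒parent (attach-link first) = branchParent-first first , ≤-refl
  Link⇒parent (branch-link ha)    = branchParent-suc ha , ≤-refl

  tree-parent : ParentFunction tree
  tree-parent = record
    { parent = λ n → ⌊ parentᵛ (decode n) ⌋ ; depth = λ n → depthᵛ (decode n) ; oriented = oriented }
    where
    lift : ∀ {u v} → Link (decode u) (decode v) →
           ⌊ parentᵛ (decode v) ⌋ ≡ u × depthᵛ (decode u) < depthᵛ (decode v)
    lift {u} u→v = trans (cong ⌊_⌋ (proj₁ (Link⇒parent u→v))) (⌊⌋-decode u) , proj₂ (Link⇒parent u→v)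
    oriented : ∀ {u v} → adjacent u v ≡ true →
      (⌊ parentᵛ (decode v) ⌋ ≡ u × depthᵛ (decode u) < depthᵛ (decode v)) ⊎
      (⌊ parentᵛ (decode u) ⌋ ≡ v × depthᵛ (decode v) < depthᵛ (decode u))
    oriented {u} {v} adj = Data.Sum.map (lift {u} {v}) (lift {v} {u}) (linked-sound (decode u) (decode v) adj)

  Link⇒adjacent : ∀ {x y} → Link x y → adjacent ⌊ x ⌋ ⌊ y ⌋ ≡ true × adjacent ⌊ y ⌋ ⌊ x ⌋ ≡ true
  Link⇒adjacent {x} {y} x→y = trans (adjacent-⌊⌋ x y) (proj₁ (Link⇒linked x→y))
                           , trans (adjacent-⌊⌋ y x) (proj₂ (Link⇒linked x→y))

  trunk-ray : ∀ {E a b} → a ≤ b → (∀ {j} → a ≤ j → j < b → ¬ Removed E ⌊ trunk j ⌋ ⌊ trunk (suc j) ⌋) →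
              Reach tree E ⌊ trunk a ⌋ ⌊ trunk b ⌋
  trunk-ray a≤b kept =
    ray (λ j → ⌊ trunk j ⌋) a≤b λ {j} a≤j j<b → proj₁ (Link⇒adjacent (trunk-link j)) , kept a≤j j<b

  branch-ray : ∀ {E a b} → h a ≡ true → a ≤ b →
               (∀ {j} → a ≤ j → j < b → ¬ Removed E ⌊ branch j ⌋ ⌊ branch (suc j) ⌋) →
               Reach tree E ⌊ branch a ⌋ ⌊ branch b ⌋
  branch-ray ha a≤b kept =
    ray (λ j → ⌊ branch j ⌋) a≤b λ {j} a≤j j<b →
      proj₁ (Link⇒adjacent (branch-link {j} (h-mono-≤ a≤j ha))) , kept a≤j j<b

  nothing-removed : ∀ {u v} → ¬ Removed [] u v
  nothing-removed (inj₁ ())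
  nothing-removed (inj₂ ())

  reach-from-root : ∀ x → present x ≡ true → Reach tree [] ⌊ trunk 0 ⌋ ⌊ x ⌋
  reach-from-root (trunk a)  _  = trunk-ray {a = 0} {a} z≤n λ _ _ → nothing-removed
  reach-from-root (branch a) ha with first-≤ a ha
  ... | s , first-s , s≤a = reach-trans (reach-trans
          (trunk-ray {a = 0} {s} z≤n λ _ _ → nothing-removed)
          (step here (proj₁ (Link⇒adjacent (attach-link {s} first-s))) nothing-removed))
          (branch-ray {a = s} {a} (isFirst⇒h s first-s) s≤a λ _ _ → nothing-removed)

  tree-isTree : IsTree tree
  tree-isTree = (0 , refl) , connected , acyclic tree-parent
    where
    from-root : ∀ v → vertex v ≡ true → Reach tree [] ⌊ trunk 0 ⌋ v
    from-root v present-v = subst (Reach tree [] _) (⌊⌋-decode v) (reach-from-root (decode v) present-v)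
    connected : ∀ u v → vertex u ≡ true → vertex v ≡ true → Reach tree [] u v
    connected u v present-u present-v = reach-trans (reach-sym (from-root u present-u)) (from-root v present-v)

  -- Cutting the trunk leaves an infinite part on both sides iff the branch hangs below the cut.
  splittingᵛ : Vertex → Vertex → Bool
  splittingᵛ (trunk a) (trunk b) = h a ∧ h b
  splittingᵛ _         _         = true

  splitting : ℕ → ℕ → Bool
  splitting u v = splittingᵛ (decode u) (decode v)

  splitting-⌊⌋ : ∀ x y → splitting ⌊ x ⌋ ⌊ y ⌋ ≡ splittingᵛ x y
  splitting-⌊⌋ x y = cong₂ splittingᵛ (decode-⌊⌋ x) (decode-⌊⌋ y)

  splittingᵛ-sym : ∀ x y → splittingᵛ x y ≡ splittingᵛ y x
  splittingᵛ-sym (trunk a)  (trunk b)  = ∧-comm (h a) (h b)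
  splittingᵛ-sym (trunk a)  (branch b) = refl
  splittingᵛ-sym (branch a) (trunk b)  = refl
  splittingᵛ-sym (branch a) (branch b) = refl

  module _ {E : List (ℕ × ℕ)} where

    private
      B = bound E

      beyond : ∀ {j} → B ≤ j → B ≤ j + j
      beyond {j} B≤j = ≤-trans B≤j (m≤m+n j j)

      trunk<bound : ∀ {j v} → Removed E ⌊ trunk j ⌋ v → j < B
      trunk<bound removed = ≤-<-trans (m≤m+n _ _) (proj₁ (Removed⇒<bound removed))

      branch<bound : ∀ {j v} → Removed E ⌊ branch j ⌋ v → j < B
      branch<bound removed = ≤-<-trans (m≤n⇒m≤1+n (m≤m+n _ _)) (proj₁ (Removed⇒<bound removed))

    trunk-infinite : ∀ {a} → B ≤ a → ¬ Finite (Reach tree E ⌊ trunk a ⌋)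
    trunk-infinite {a} B≤a = unbounded⇒infinite λ n →
      ⌊ trunk (a + suc n) ⌋ , ≤-trans (m≤n+m (suc n) a) (m≤m+n _ _) ,
      trunk-ray (m≤m+n a (suc n)) λ a≤j _ → beyond-bound (beyond (≤-trans B≤a a≤j))

    branch-infinite : ∀ {a} → h a ≡ true → B ≤ a → ¬ Finite (Reach tree E ⌊ branch a ⌋)
    branch-infinite {a} ha B≤a = unbounded⇒infinite λ n →
      ⌊ branch (a + n) ⌋ , s≤s (≤-trans (m≤n+m n a) (m≤m+n _ _)) ,
      branch-ray ha (m≤m+n a n) λ a≤j _ → beyond-bound (m≤n⇒m≤1+n (beyond (≤-trans B≤a a≤j)))

    ClosedUnder : (Vertex → Set) → Set
    ClosedUnder S = ∀ {x y} → S x → Linked x y → ¬ Removed E ⌊ x ⌋ ⌊ y ⌋ → S y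

    ClosedUnder⇒Closed : ∀ {S} → ClosedUnder S → Closed tree E (S ∘ decode)
    ClosedUnder⇒Closed closed {u} {w} Su adj kept = closed Su (linked-sound (decode u) (decode w) adj)
      (subst₂ (λ a b → ¬ Removed E a b) (sym (⌊⌋-decode u)) (sym (⌊⌋-decode w)) kept)

    separated : ∀ S → ClosedUnder S → ∀ {x y} → S x → ¬ S y → present x ≡ true → present y ≡ true →
                ¬ Finite (Reach tree E ⌊ x ⌋) → ¬ Finite (Reach tree E ⌊ y ⌋) → AtLeastInfComps tree E 2
    separated S closed {x} {y} Sx ¬Sy px py ∞x ∞y =
      two-infinite-components (S ∘ decode) (ClosedUnder⇒Closed closed)
        (subst S (sym (decode-⌊⌋ x)) Sx) (¬Sy ∘ subst S (decode-⌊⌋ y))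
        (trans (cong present (decode-⌊⌋ x)) px) (trans (cong present (decode-⌊⌋ y)) py) ∞x ∞y

    cut-trunk : ∀ {j} → h j ≡ true → Removed E ⌊ trunk j ⌋ ⌊ trunk (suc j) ⌋ → AtLeastInfComps tree E 2
    cut-trunk {j} hj cut =
      separated Beyond closed {trunk B} {branch B} j<B (λ ()) refl hB
        (trunk-infinite {B} ≤-refl) (branch-infinite {B} hB ≤-refl)
      where
      j<B = trunk<bound cut
      hB  = h-mono-≤ (<⇒≤ j<B) hj
      Beyond : Vertex → Set
      Beyond (trunk i)  = j < i
      Beyond (branch _) = ⊥
      closed : ClosedUnder Beyond
      closed j<i (inj₁ (trunk-link _))     _ = m<n⇒m<1+n j<i
      closed j<i (inj₁ (attach-link first-i)) _ = ⊥-elim (<⇒≱ j<i (isFirst-least first-i hj))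
      closed j<i (inj₂ (trunk-link i))     kept with m≤n⇒m<n∨m≡n (≤-pred j<i)
      ... | inj₁ j<i′ = j<i′
      ... | inj₂ refl = ⊥-elim (kept (Removed-sym cut))

    cut-attach : ∀ {s} → isFirst s ≡ true → Removed E ⌊ trunk s ⌋ ⌊ branch s ⌋ → AtLeastInfComps tree E 2
    cut-attach {s} first-s cut =
      separated OnBranch closed {branch B} {trunk B} tt (λ ()) hB refl
        (branch-infinite {B} hB ≤-refl) (trunk-infinite {B} ≤-refl)
      where
      hB = h-mono-≤ (<⇒≤ (trunk<bound cut)) (isFirst⇒h s first-s)
      OnBranch : Vertex → Set
      OnBranch (trunk _)  = ⊥
      OnBranch (branch _) = ⊤
      closed : ClosedUnder OnBranch
      closed _ (inj₁ (branch-link _))      _ = tt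
      closed _ (inj₂ (branch-link _))      _ = tt
      closed {branch k} _ (inj₂ (attach-link first-k)) kept with isFirst-unique {k} {s} first-k first-s
      ... | refl = ⊥-elim (kept (Removed-sym cut))

    cut-branch : ∀ {j} → h j ≡ true → Removed E ⌊ branch j ⌋ ⌊ branch (suc j) ⌋ → AtLeastInfComps tree E 2
    cut-branch {j} hj cut =
      separated Beyond closed {branch B} {trunk B} j<B (λ ()) hB refl
        (branch-infinite {B} hB ≤-refl) (trunk-infinite {B} ≤-refl)
      where
      j<B = branch<bound cut
      hB  = h-mono-≤ (<⇒≤ j<B) hj
      Beyond : Vertex → Set
      Beyond (trunk _)  = ⊥
      Beyond (branch k) = j < k
      closed : ClosedUnder Beyond
      closed j<k (inj₁ (branch-link _))     _ = m<n⇒m<1+n j<k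
      closed j<k (inj₂ (attach-link first-k)) _ = ⊥-elim (<⇒≱ j<k (isFirst-least first-k hj))
      closed j<k (inj₂ (branch-link _))     kept with m≤n⇒m<n∨m≡n (≤-pred j<k)
      ... | inj₁ j<k′ = j<k′
      ... | inj₂ refl = ⊥-elim (kept (Removed-sym cut))

    cut : ∀ {x y} → Link x y → splittingᵛ x y ≡ true → Removed E ⌊ x ⌋ ⌊ y ⌋ → AtLeastInfComps tree E 2
    cut (trunk-link j)      split removed = cut-trunk (proj₁ (∧-true split)) removed
    cut (attach-link {s} first-s) _ removed = cut-attach {s} first-s removed
    cut (branch-link hj)    _     removed = cut-branch hj removed

    removal-splits : EdgeSet tree E → ∀ {u v} → (u , v) ∈ E → splitting u v ≡ true → AtLeastInfComps tree E 2
    removal-splits E⊆T {u} {v} uv∈E split = cutᵛ (linked-sound (decode u) (decode v) (All.lookup E⊆T uv∈E)) split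
      (subst₂ (Removed E) (sym (⌊⌋-decode u)) (sym (⌊⌋-decode v)) (inj₁ uv∈E))
      where
      cutᵛ : ∀ {x y} → Linked x y → splittingᵛ x y ≡ true → Removed E ⌊ x ⌋ ⌊ y ⌋ → AtLeastInfComps tree E 2
      cutᵛ (inj₁ x→y) split removed = cut x→y split removed
      cutᵛ {x} {y} (inj₂ y→x) split removed = cut y→x (trans (splittingᵛ-sym y x) split) (Removed-sym removed)

    module _ (unsplit : All.All (λ e → splitting (proj₁ e) (proj₂ e) ≡ false) E) where

      removed⇒unsplit : ∀ x y → Removed E ⌊ x ⌋ ⌊ y ⌋ → splittingᵛ x y ≡ false
      removed⇒unsplit x y (inj₁ xy∈E) = trans (sym (splitting-⌊⌋ x y)) (All.lookup unsplit xy∈E)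
      removed⇒unsplit x y (inj₂ yx∈E) =
        trans (splittingᵛ-sym x y) (trans (sym (splitting-⌊⌋ y x)) (All.lookup unsplit yx∈E))

      kept : ∀ x y → splittingᵛ x y ≡ true → ¬ Removed E ⌊ x ⌋ ⌊ y ⌋
      kept x y split removed with trans (sym split) (removed⇒unsplit x y removed)
      ... | ()

      prefix-finite : ∀ {a} → Removed E ⌊ trunk a ⌋ ⌊ trunk (suc a) ⌋ → Finite (Reach tree E ⌊ trunk a ⌋)
      prefix-finite {a} removed =
        applyUpTo (λ i → ⌊ trunk i ⌋) (suc a) ,
        λ w a↝w → listed w
          (reach-closed (ClosedUnder⇒Closed closed) (subst UpTo (sym (decode-⌊⌋ (trunk a))) ≤-refl) a↝w)
        where
        ¬ha : h a ≡ false
        ¬ha = ¬-not λ ha → kept (trunk a) (trunk (suc a)) (cong₂ _∧_ ha (h-mono a ha)) removed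
        UpTo : Vertex → Set
        UpTo (trunk i)  = i ≤ a
        UpTo (branch _) = ⊥
        closed : ClosedUnder UpTo
        closed {trunk i} i≤a (inj₁ (trunk-link _)) kept-edge with m≤n⇒m<n∨m≡n i≤a
        ... | inj₁ i<a  = i<a
        ... | inj₂ refl = ⊥-elim (kept-edge removed)
        closed {trunk i} i≤a (inj₁ (attach-link first-i)) _
          with trans (sym (h-mono-≤ i≤a (isFirst⇒h i first-i))) ¬ha
        ... | ()
        closed 1+i≤a (inj₂ (trunk-link i)) _ = ≤-trans (n≤1+n i) 1+i≤a
        listed : ∀ w → UpTo (decode w) → w ∈ applyUpTo (λ i → ⌊ trunk i ⌋) (suc a)
        listed w up with decode w | ⌊⌋-decode w
        ... | trunk i | refl = ∈-applyUpTo⁺ (λ i → ⌊ trunk i ⌋) (s≤s up)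

      reach-far-trunk : ∀ d {a} → a + d ≡ B → ¬ Finite (Reach tree E ⌊ trunk a ⌋) →
                        Reach tree E ⌊ trunk a ⌋ ⌊ trunk B ⌋
      reach-far-trunk zero    {a} a+0≡B _ =
        subst (λ b → Reach tree E ⌊ trunk a ⌋ ⌊ trunk b ⌋) (trans (sym (+-identityʳ a)) a+0≡B) here
      reach-far-trunk (suc d) {a} a+d≡B ∞ with Removed? E ⌊ trunk a ⌋ ⌊ trunk (suc a) ⌋
      ... | yes removed = ⊥-elim (∞ (prefix-finite removed))
      ... | no  ¬removed = reach-trans a↝a+1
              (reach-far-trunk d (trans (sym (+-suc a d)) a+d≡B) (∞ ∘ reach-finite a↝a+1))
        where a↝a+1 = step here (proj₁ (Link⇒adjacent (trunk-link a))) ¬removed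

      reach-far : ∀ x → present x ≡ true → ¬ Finite (Reach tree E ⌊ x ⌋) → Reach tree E ⌊ x ⌋ ⌊ trunk B ⌋
      reach-far (trunk a) _ ∞ with a ≤? B
      ... | yes a≤B = reach-far-trunk (B ∸ a) (m+[n∸m]≡n a≤B) ∞
      ... | no  a≰B = reach-sym (trunk-ray (≰⇒≥ a≰B) λ B≤j _ → beyond-bound (beyond B≤j))
      reach-far (branch a) ha _ with first-≤ a ha
      ... | s , first-s , s≤a = reach-trans (reach-trans
              (reach-sym (branch-ray hs s≤a λ {j} _ _ → kept (branch j) (branch (suc j)) refl))
              (step here (proj₂ (Link⇒adjacent (attach-link {s} first-s))) (kept (branch s) (trunk s) refl)))
              to-B
        where
        hs = isFirst⇒h s first-s
        to-B : Reach tree E ⌊ trunk s ⌋ ⌊ trunk B ⌋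
        to-B with s ≤? B
        ... | yes s≤B = trunk-ray s≤B λ {j} s≤j _ →
                kept (trunk j) (trunk (suc j)) (cong₂ _∧_ (h-mono-≤ s≤j hs) (h-mono-≤ (m≤n⇒m≤1+n s≤j) hs))
        ... | no  s≰B = reach-sym (trunk-ray (≰⇒≥ s≰B) λ B≤j _ → beyond-bound (beyond B≤j))

      at-most-one : ¬ AtLeastInfComps tree E 2
      at-most-one (vs , Vvs , apart , infinite) = apart Fin.zero (Fin.suc Fin.zero) (λ ())
        (reach-trans (far Fin.zero) (reach-sym (far (Fin.suc Fin.zero))))
        where
        far : ∀ i → Reach tree E (vs i) ⌊ trunk B ⌋
        far i = subst (λ v → Reach tree E v ⌊ trunk B ⌋) (⌊⌋-decode (vs i))
          (reach-far (decode (vs i)) (Vvs i)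
            (subst (λ v → ¬ Finite (Reach tree E v)) (sym (⌊⌋-decode (vs i))) (infinite i)))

  decide : List (ℕ × ℕ) → Bool
  decide E = all (uncurry adjacent) E ∧ any (uncurry splitting) E

  decide-true : ∀ E → decide E ≡ true → InTwoInfColl tree E
  decide-true E accepted with ∧-true {all (uncurry adjacent) E} accepted
  ... | all-adjacent , any-splitting with any-true⁻ (uncurry splitting) E any-splitting
  ...   | (u , v) , uv∈E , split = E⊆T , removal-splits E⊆T uv∈E split
    where E⊆T = all-true⁻ (uncurry adjacent) E all-adjacent

  decide-false : ∀ E → decide E ≡ false → ¬ InTwoInfColl tree E
  decide-false E rejected (E⊆T , two) rewrite all-true⁺ (uncurry adjacent) E⊆T =
    at-most-one (any-false⁻ (uncurry splitting) E rejected) two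

  ends-≥1 : EndsAtLeast tree 1
  ends-≥1 = [] , [] , (λ _ → ⌊ trunk 0 ⌋) , (λ _ → refl) , apart , (λ _ → trunk-infinite {[]} {0} z≤n)
    where
    apart : ∀ (i j : Fin 1) → i ≢ j → ¬ Reach tree [] ⌊ trunk 0 ⌋ ⌊ trunk 0 ⌋
    apart Fin.zero Fin.zero i≢j = ⊥-elim (i≢j refl)

  ends-≥2 : ∀ {j} → h j ≡ true → EndsAtLeast tree 2
  ends-≥2 {j} hj = E , proj₁ (Link⇒adjacent (trunk-link j)) ∷ [] , cut-trunk hj (inj₁ (here refl))
    where E = (⌊ trunk j ⌋ , ⌊ trunk (suc j) ⌋) ∷ []

  ends-<2 : (∀ j → h j ≡ false) → ¬ EndsAtLeast tree 2
  ends-<2 never (E , E⊆T , two) = at-most-one (All.map (λ {e} → unsplit e) E⊆T) two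
    where
    h-false : ∀ {a} → h a ≡ true → ⊥
    h-false {a} ha with trans (sym ha) (never a)
    ... | ()
    unsplitᵛ : ∀ {x y} → Linked x y → splittingᵛ x y ≡ false
    unsplitᵛ (inj₁ (trunk-link j))             rewrite never j = refl
    unsplitᵛ (inj₂ (trunk-link j))             rewrite never j = ∧-zeroʳ _
    unsplitᵛ (inj₁ (attach-link {a} first-a)) = ⊥-elim (h-false (isFirst⇒h a first-a))
    unsplitᵛ (inj₂ (attach-link {a} first-a)) = ⊥-elim (h-false (isFirst⇒h a first-a))
    unsplitᵛ (inj₁ (branch-link ha))           = ⊥-elim (h-false ha)
    unsplitᵛ (inj₂ (branch-link ha))           = ⊥-elim (h-false ha)
    unsplit : ∀ e → adjacent (proj₁ e) (proj₂ e) ≡ true → splitting (proj₁ e) (proj₂ e) ≡ false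
    unsplit (u , v) adj = unsplitᵛ (linked-sound (decode u) (decode v) adj)

module Family (e : ℕ) = Tree (haltsWith2 e) (haltsWith2-mono e)

oddᶠ : CFun 1
oddᶠ = recursion (term (num 0)) (term λ n r → call notᶠ r) (λ n → χ (odd n)) refl (λ n → χ-not (odd n))

halfᶠ : CFun 1
halfᶠ = recursion (term (num 0)) (term λ n r → call ifzᶠ (call oddᶠ n) r (call succᶠ r)) half refl
  (λ n → ifz-χ (odd n) _ _)

isFirstᶠ : CFun 2
isFirstᶠ = compute
  (λ e j → call ifzᶠ j (call haltsWith2ᶠ e (num 0))
    (call andᶠ (call notᶠ (call haltsWith2ᶠ e (call predᶠ j))) (call haltsWith2ᶠ e j)))
  (λ e j → χ (Family.isFirst e j))
  λ { e zero → refl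
    ; e (suc j) → trans (cong (λ x → ifz x 0 (χ (haltsWith2 e (suc j)))) (χ-not (haltsWith2 e j)))
                        (χ-∧ (not (haltsWith2 e j)) (haltsWith2 e (suc j))) }

vertexᶠ : CFun 2
vertexᶠ = compute (λ e v → call ifzᶠ (call oddᶠ v) (num 1) (call haltsWith2ᶠ e (call halfᶠ v)))
  (λ e v → χ (Family.vertex e v)) proof
  where
  proof : ∀ e v → ifz (χ (odd v)) 1 (χ (haltsWith2 e (half v))) ≡ χ (Family.vertex e v)
  proof e v with odd v
  ... | false = refl
  ... | true  = refl

adjacentᶠ : CFun 3
adjacentᶠ = compute (λ e u v → call linkedᶠ e (call oddᶠ u) (call halfᶠ u) (call oddᶠ v) (call halfᶠ v))
  (λ e u v → χ (Family.adjacent e u v)) proof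
  where
  linkedᶠ : CFun 5
  linkedᶠ = term λ e p a q b → call ifzᶠ p
    (call ifzᶠ q
      (call orᶠ (call eqᶠ (call succᶠ a) b) (call eqᶠ (call succᶠ b) a))
      (call andᶠ (call eqᶠ a b) (call isFirstᶠ e a)))
    (call ifzᶠ q
      (call andᶠ (call eqᶠ a b) (call isFirstᶠ e b))
      (call orᶠ (call andᶠ (call eqᶠ (call succᶠ a) b) (call haltsWith2ᶠ e a))
                (call andᶠ (call eqᶠ (call succᶠ b) a) (call haltsWith2ᶠ e b))))
  proof : ∀ e u v → fun linkedᶠ (e ∷ᵛ χ (odd u) ∷ᵛ half u ∷ᵛ χ (odd v) ∷ᵛ half v ∷ᵛ []ᵛ) ≡
                    χ (Family.adjacent e u v)
  proof e u v with odd u | odd v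
  ... | false | false = χ-∨ (does (suc a ≟ b)) (does (suc b ≟ a))
    where a = half u ; b = half v
  ... | false | true  = χ-∧ (does (half u ≟ half v)) (Family.isFirst e (half u))
  ... | true  | false = χ-∧ (does (half u ≟ half v)) (Family.isFirst e (half v))
  ... | true  | true  = trans (cong₂ (λ x y → ifz x y 1) (χ-∧ (does (suc a ≟ b)) (haltsWith2 e a))
                                                         (χ-∧ (does (suc b ≟ a)) (haltsWith2 e b)))
                              (χ-∨ (does (suc a ≟ b) ∧ haltsWith2 e a) (does (suc b ≟ a) ∧ haltsWith2 e b))
    where a = half u ; b = half v

degreeᶠ : CFun 2
degreeᶠ = compute
  (λ e v → call ifzᶠ (call oddᶠ v)
    (call succᶠ (call addᶠ (call ifzᶠ (call halfᶠ v) (num 0) (num 1)) (call isFirstᶠ e (call halfᶠ v))))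
    (num 2))
  (λ e v → Family.degree e v) proof
  where
  attachment-size : ∀ e a → length (map ⌊_⌋ (Family.attachment e a)) ≡ χ (Family.isFirst e a)
  attachment-size e a with Family.isFirst e a
  ... | false = refl
  ... | true  = refl
  proof : ∀ e v → ifz (χ (odd v)) (suc (ifz (half v) 0 1 + χ (Family.isFirst e (half v)))) 2 ≡ Family.degree e v
  proof e v with odd v | half v
  ... | true  | _     = refl
  ... | false | zero  = cong suc (sym (attachment-size e 0))
  ... | false | suc a = cong (suc ∘ suc) (sym (attachment-size e (suc a)))

splittingᶠ : CFun 3
splittingᶠ = compute
  (λ e u v → call ifzᶠ (call oddᶠ u)
    (call ifzᶠ (call oddᶠ v)
      (call andᶠ (call haltsWith2ᶠ e (call halfᶠ u)) (call haltsWith2ᶠ e (call halfᶠ v))) (num 1))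
    (num 1))
  (λ e u v → χ (Family.splitting e u v)) proof
  where
  proof : ∀ e u v →
    ifz (χ (odd u)) (ifz (χ (odd v)) (ifz (χ (haltsWith2 e (half u))) 0 (χ (haltsWith2 e (half v)))) 1) 1 ≡
    χ (Family.splitting e u v)
  proof e u v with odd u | odd v
  ... | false | false = χ-∧ (haltsWith2 e (half u)) (haltsWith2 e (half v))
  ... | false | true  = refl
  ... | true  | _     = refl

decideᶠ : CFun 2
decideᶠ = compute
  (λ e l → call andᶠ (call (allEdgesᶠ adjacentᶠ Family.adjacent λ _ _ _ → refl) e l)
                     (call (anyEdgesᶠ splittingᶠ Family.splitting λ _ _ _ → refl) e l))
  (λ e l → χ (allEdges (Family.adjacent e) l ∧ anyEdges (Family.splitting e) l))
  (λ e l → χ-∧ (allEdges (Family.adjacent e) l) (anyEdges (Family.splitting e) l))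

decideᶠ-encEdges : ∀ e E → Eval (code decideᶠ) (e ∷ encEdges E ∷ []) (χ (Family.decide e E))
decideᶠ-encEdges e E = subst (Eval (code decideᶠ) (e ∷ encEdges E ∷ []))
  (cong χ (cong₂ _∧_ (allEdges-encEdges (Family.adjacent e) E) (anyEdges-encEdges (Family.splitting e) E)))
  (correct decideᶠ (e ∷ᵛ encEdges E ∷ᵛ []ᵛ))

χ-decides : ∀ {P : Set} b → (b ≡ true → P) → (b ≡ false → ¬ P) →
            (P → χ b ≡ 1) × (¬ P → χ b ≡ 0)
χ-decides true  b⇒P _    = (λ _ → refl) , (λ ¬P → ⊥-elim (¬P (b⇒P refl)))
χ-decides false _   b⇒¬P = (λ P → ⊥-elim (b⇒¬P refl P)) , (λ _ → refl)

family : ℕ → Graph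
family = Family.tree

family-computable : UniformlyHighlyComputable family
family-computable = (code vertexᶠ   , λ e v   → correct vertexᶠ   (e ∷ᵛ v ∷ᵛ []ᵛ))
                  , (code adjacentᶠ , λ e u v → correct adjacentᶠ (e ∷ᵛ u ∷ᵛ v ∷ᵛ []ᵛ))
                  , (code degreeᶠ   , λ e v   → correct degreeᶠ   (e ∷ᵛ v ∷ᵛ []ᵛ))

twoInf-computable : TwoInfUniformlyComputable family
twoInf-computable = code decideᶠ , λ e E →
  let accept , reject = χ-decides (Family.decide e E) (Family.decide-true e E) (Family.decide-false e E)
  in (λ two → subst (Eval _ _) (accept two) (decideᶠ-encEdges e E))
   , (λ ¬two → subst (Eval _ _) (reject ¬two) (decideᶠ-encEdges e E))

output2⇒two-ends : ∀ c → Eval c (⌜ c ⌝ ∷ []) 2 → EndsAtLeast (family ⌜ c ⌝) 2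
output2⇒two-ends c c⇓2 = Family.ends-≥2 ⌜ c ⌝ {proj₁ halts} (proj₂ halts)
  where halts = haltsWith2-complete c c⇓2

output≢2⇒one-end : ∀ c {n} → Eval c (⌜ c ⌝ ∷ []) n → n ≢ 2 → HasEnds (family ⌜ c ⌝) 2
output≢2⇒one-end c c⇓n n≢2 = Family.ends-≥1 ⌜ c ⌝ , Family.ends-<2 ⌜ c ⌝ never
  where
  never : ∀ j → haltsWith2 ⌜ c ⌝ j ≡ false
  never j = ¬-not λ halts → n≢2 (haltsWith2-sound c c⇓n j halts)

ends-not-computable : ¬ EndsUniformlyComputable family
ends-not-computable (c , computes) with computes ⌜ c ⌝
... | n , c⇓n , n-ends with n ≟ 2
...   | yes refl = proj₂ n-ends (output2⇒two-ends c c⇓n)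
...   | no  n≢2  = n≢2 (HasEnds-functional n-ends (output≢2⇒one-end c c⇓n n≢2))

proposition5p10 : Σ (ℕ → Graph) λ G →
    UniformlyHighlyComputable G × (∀ e → IsTree (G e)) ×
    TwoInfUniformlyComputable G × ¬ EndsUniformlyComputable G
proposition5p10 = family , family-computable , Family.tree-isTree , twoInf-computable , ends-not-computable
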